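{- Let $k\geqslant2$ and $0<\theta_1,\ldots,\theta_k\leqslant1$ with $\theta_1+\cdots+\theta_k>1$. Put $$\theta=\min\Bigl\{\theta_1,\ldots,\theta_k,\frac{\theta_1+\cdots+\theta_k-1}{3k-5}\Bigr\}.$$ Let $N$ be a prime with $N>2\theta^{ -2}$, and let $X_1,\ldots,X_k$ be subsets of $\mathbb Z_N$ with $|X_i|\geqslant\theta_iN$ for each $i$. Then for every $n\in\mathbb Z_N$, $$\nu_{X_1,\ldots,X_k}(n)\geqslant\theta^{2k-3}N^{k-1}.$$
   Context: $\mathbb Z_N=\mathbb Z/N\mathbb Z$. For nonempty subsets $X_1,\ldots,X_k$ of $\mathbb Z_N$ and $n\in\mathbb Z_N$, $\nu_{X_1,\ldots,X_k}(n)$ denotes the number of tuples $(x_1,\ldots,x_k)$ with $x_i\in X_i$ for all $i$ and $x_1+\cdots+x_k=n$ in $\mathbb Z_N$.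
   Formalization: The parameters $\theta_1,\ldots,\theta_k$ range over the rationals. -}

module Defs where

open import Data.Nat as ℕ using (ℕ; zero; suc; _%_)
open import Data.Fin using (Fin; toℕ)
open import Data.Fin.Subset using (Subset; _∈_)
open import Data.Fin.Subset.Properties using (_∈?_)
open import Data.Fin.Properties using (all?)
open import Data.Vec using (Vec; []; _∷_; lookup; toList)
open import Data.List as List using (List; []; _∷_; concatMap; allFin; length; filter)
open import Data.Nat.ListAction using (sum)
open import Relation.Nullary.Decidable using (_×-dec_)
open import Data.Integer using (+_)
open import Data.Rational using (ℚ; _/_; _*_; 1ℚ; 0ℚ)

-- Reduction of a natural number modulo N (N > 0 in all uses, since N is prime).
modN : ℕ → ℕ → ℕ
modN zero a = a
modN (suc m) a = a % suc m

allTuples : (k N : ℕ) → List (Vec (Fin N) k)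
allTuples zero N = [] ∷ []
allTuples (suc k) N = concatMap (λ x → List.map (x ∷_) (allTuples k N)) (allFin N)

ν : (N k : ℕ) → (Fin k → Subset N) → Fin N → ℕ
ν N k X n = length (filter (λ xs → all? (λ i → lookup xs i ∈? X i)
                                  ×-dec (modN N (sum (List.map toℕ (toList xs))) ℕ.≟ toℕ n))
                           (allTuples k N))

ℕtoℚ : ℕ → ℚ
ℕtoℚ n = (+ n) / 1

_^ℚ_ : ℚ → ℕ → ℚ
q ^ℚ zero = 1ℚ
q ^ℚ suc m = q * (q ^ℚ m)

-- 1/(3k-5) for k ≥ 2 (value irrelevant for k < 2)
inv3k-5 : ℕ → ℚ
inv3k-5 (suc (suc j)) = (+ 1) / suc (3 ℕ.* j)
inv3k-5 _ = 0ℚ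

sumℚ : (k : ℕ) → (Fin k → ℚ) → ℚ
sumℚ k θ = List.foldr Data.Rational._+_ 0ℚ (List.map θ (allFin k))
  where import Data.Rational

θmin : (k : ℕ) → (Fin k → ℚ) → ℚ
θmin k θ = List.foldr Data.Rational._⊓_ ((sumℚ k θ Data.Rational.- 1ℚ) * inv3k-5 k) (List.map θ (allFin k))
  where import Data.Rational

-- Clearing denominators (θ = m/D, θᵢ = mᵢ/D), the claim becomes (m²N)^(k−2)·mN ≤ (D²)^(k−2)·D·ν, proved by
-- induction on the number of sets. A set of weight mᵢ ≤ 3m is dropped: summing over its elements costs the
-- factor |Xᵢ| ≥ θN, and θ ≤ 1 pays for the second factor. Otherwise two sets A, B are replaced by
-- Y = {y : r_{A,B}(y) ≥ s} with s = ⌈θ²N⌉, at the cost of the factor s. Pollard's theorem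
-- ∑_y min(t, r_{A,B}(y)) ≥ t(|A| + |B| − t), applied with t = ⌈θN⌉, gives |Y| ≥ (θ_A + θ_B − 3θ)N, and the
-- loss 3θ in the total density is covered by θ ≤ (∑θᵢ − 1)/(3k − 5). With two sets left, r_{A,B}(n) ≥
-- |A| + |B| − N ≥ θN. Pollard's theorem is proved by induction on |B| via Dyson's e-transform, which keeps
-- |A| + |B| and does not increase r_{A,B}; when the transform would make B smaller than t one passes to
-- ∁A and |B| − t instead, and a transform that shrinks B properly exists because N is prime.

module Submission where

open import Data.Nat using (ℕ; suc)
open import Data.Nat.Primality using (Prime)
open import Data.Fin using (Fin)
open import Data.Rational using (ℚ; 0ℚ; 1ℚ)
import Data.Rational as ℚ
open import Defs

module FiniteSums where

  open import Data.Nat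
  open import Data.Nat.Properties
  open import Data.Bool using (Bool; true; false; not; _∧_; _∨_)
  open import Data.Product using (∃; _×_; _,_)
  open import Data.Sum using (inj₁; inj₂)
  open import Data.Nat.Tactic.RingSolver using (solve-∀)
  open import Function using (_∘_)
  open import Relation.Binary.PropositionalEquality
  open import Relation.Nullary using (contradiction)
  open ≡-Reasoning

  ∑ : ℕ → (ℕ → ℕ) → ℕ
  ∑ zero    f = 0
  ∑ (suc n) f = f 0 + ∑ n (f ∘ suc)

  syntax ∑ n (λ x → e) = ∑[ x < n ] e

  ∑-cong-< : ∀ n {f g : ℕ → ℕ} → (∀ x → x < n → f x ≡ g x) → ∑ n f ≡ ∑ n g
  ∑-cong-< zero    f≡g = refl
  ∑-cong-< (suc n) f≡g = cong₂ _+_ (f≡g 0 z<s) (∑-cong-< n (λ x x<n → f≡g (suc x) (s<s x<n)))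

  ∑-cong : ∀ n {f g : ℕ → ℕ} → f ≗ g → ∑ n f ≡ ∑ n g
  ∑-cong n f≗g = ∑-cong-< n (λ x _ → f≗g x)

  ∑-mono-≤ : ∀ n {f g : ℕ → ℕ} → (∀ x → x < n → f x ≤ g x) → ∑ n f ≤ ∑ n g
  ∑-mono-≤ zero    f≤g = z≤n
  ∑-mono-≤ (suc n) f≤g = +-mono-≤ (f≤g 0 z<s) (∑-mono-≤ n (λ x x<n → f≤g (suc x) (s<s x<n)))

  ∑-distrib-+ : ∀ n (f g : ℕ → ℕ) → ∑[ x < n ] (f x + g x) ≡ ∑ n f + ∑ n g
  ∑-distrib-+ zero    f g = refl
  ∑-distrib-+ (suc n) f g = begin
    f 0 + g 0 + ∑[ x < n ] (f (suc x) + g (suc x))   ≡⟨ cong (f 0 + g 0 +_) (∑-distrib-+ n (f ∘ suc) (g ∘ suc)) ⟩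
    f 0 + g 0 + (∑ n (f ∘ suc) + ∑ n (g ∘ suc))     ≡⟨ +-assoc-middle (f 0) (g 0) _ _ ⟩
    f 0 + ∑ n (f ∘ suc) + (g 0 + ∑ n (g ∘ suc))     ∎
    where
    +-assoc-middle : ∀ a b c d → a + b + (c + d) ≡ a + c + (b + d)
    +-assoc-middle = solve-∀

  ∑-distribˡ-* : ∀ n c (f : ℕ → ℕ) → ∑[ x < n ] (c * f x) ≡ c * ∑ n f
  ∑-distribˡ-* zero    c f = sym (*-zeroʳ c)
  ∑-distribˡ-* (suc n) c f = begin
    c * f 0 + ∑[ x < n ] (c * f (suc x)) ≡⟨ cong (c * f 0 +_) (∑-distribˡ-* n c (f ∘ suc)) ⟩
    c * f 0 + c * ∑ n (f ∘ suc)         ≡⟨ *-distribˡ-+ c (f 0) _ ⟨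
    c * ∑ (suc n) f                     ∎

  ∑-distribʳ-* : ∀ n c (f : ℕ → ℕ) → ∑[ x < n ] (f x * c) ≡ ∑ n f * c
  ∑-distribʳ-* n c f = begin
    ∑[ x < n ] (f x * c) ≡⟨ ∑-cong n (λ x → *-comm (f x) c) ⟩
    ∑[ x < n ] (c * f x) ≡⟨ ∑-distribˡ-* n c f ⟩
    c * ∑ n f           ≡⟨ *-comm c _ ⟩
    ∑ n f * c           ∎

  ∑-const : ∀ n c → ∑[ _ < n ] c ≡ n * c
  ∑-const zero    c = refl
  ∑-const (suc n) c = cong (c +_) (∑-const n c)

  ∑-one : ∀ n → ∑[ _ < n ] 1 ≡ n
  ∑-one n = trans (∑-const n 1) (*-identityʳ n)

  ∑-init-last : ∀ n (f : ℕ → ℕ) → ∑ (suc n) f ≡ ∑ n f + f n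
  ∑-init-last zero    f = +-comm (f 0) 0
  ∑-init-last (suc n) f = begin
    f 0 + ∑ (suc n) (f ∘ suc)          ≡⟨ cong (f 0 +_) (∑-init-last n (f ∘ suc)) ⟩
    f 0 + (∑ n (f ∘ suc) + f (suc n))  ≡⟨ +-assoc (f 0) _ _ ⟨
    f 0 + ∑ n (f ∘ suc) + f (suc n)    ∎

  ∑-comm : ∀ m n (f : ℕ → ℕ → ℕ) → ∑[ x < m ] ∑[ y < n ] f x y ≡ ∑[ y < n ] ∑[ x < m ] f x y
  ∑-comm zero    n f = sym (trans (∑-const n 0) (*-zeroʳ n))
  ∑-comm (suc m) n f = begin
    ∑[ y < n ] f 0 y + ∑[ x < m ] ∑[ y < n ] f (suc x) y ≡⟨ cong (∑[ y < n ] f 0 y +_) (∑-comm m n (f ∘ suc)) ⟩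
    ∑[ y < n ] f 0 y + ∑[ y < n ] ∑[ x < m ] f (suc x) y ≡⟨ ∑-distrib-+ n (f 0) (λ y → ∑[ x < m ] f (suc x) y) ⟨
    ∑[ y < n ] ∑[ x < suc m ] f x y                     ∎

  ∑-reverse : ∀ n (h : ℕ → ℕ) → ∑[ x < n ] h (n ∸ x) ≡ ∑[ x < n ] h (suc x)
  ∑-reverse zero    h = refl
  ∑-reverse (suc n) h = begin
    h (suc n) + ∑[ x < n ] h (n ∸ x)   ≡⟨ cong (h (suc n) +_) (∑-reverse n h) ⟩
    h (suc n) + ∑[ x < n ] h (suc x)   ≡⟨ +-comm (h (suc n)) _ ⟩
    ∑[ x < n ] h (suc x) + h (suc n)   ≡⟨ ∑-init-last n (h ∘ suc) ⟨
    ∑[ x < suc n ] h (suc x)           ∎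

  term≤∑ : ∀ n (f : ℕ → ℕ) {x} → x < n → f x ≤ ∑ n f
  term≤∑ (suc n) f {zero}  _         = m≤m+n (f 0) _
  term≤∑ (suc n) f {suc x} (s<s x<n) = ≤-trans (term≤∑ n (f ∘ suc) x<n) (m≤n+m _ (f 0))

  ∑-pos⇒∃-pos : ∀ n (f : ℕ → ℕ) → 0 < ∑ n f → ∃ λ x → x < n × 0 < f x
  ∑-pos⇒∃-pos (suc n) f ∑f>0 with f 0 in f0≡
  ... | suc _ = 0 , z<s , subst (0 <_) (sym f0≡) z<s
  ... | zero with ∑-pos⇒∃-pos n (f ∘ suc) ∑f>0
  ...   | x , x<n , fx>0 = suc x , s<s x<n , fx>0

  ∑-≤-≡⇒≡ : ∀ n {f g : ℕ → ℕ} → (∀ x → x < n → f x ≤ g x) → ∑ n f ≡ ∑ n g → ∀ x → x < n → f x ≡ g x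
  ∑-≤-≡⇒≡ (suc n) {f} {g} f≤g ∑f≡∑g x x<n with m≤n⇒m<n∨m≡n (f≤g 0 z<s)
  ... | inj₁ f0<g0 = contradiction ∑f≡∑g (<⇒≢ (+-mono-<-≤ f0<g0 (∑-mono-≤ n (λ y y<n → f≤g (suc y) (s<s y<n)))))
  ... | inj₂ f0≡g0 with x | x<n
  ...   | zero  | _         = f0≡g0
  ...   | suc y | s<s y<n   = ∑-≤-≡⇒≡ n (λ z z<n → f≤g (suc z) (s<s z<n))
                                (+-cancelˡ-≡ (f 0) _ _ (trans ∑f≡∑g (cong (_+ ∑ n (g ∘ suc)) (sym f0≡g0)))) y y<n

  𝟙 : Bool → ℕ
  𝟙 true  = 1
  𝟙 false = 0

  𝟙≤1 : ∀ b → 𝟙 b ≤ 1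
  𝟙≤1 true  = ≤-refl
  𝟙≤1 false = z≤n

  𝟙-pos⇒true : ∀ {b} → 0 < 𝟙 b → b ≡ true
  𝟙-pos⇒true {true} _ = refl

  𝟙-∧-≤ : ∀ a b → 𝟙 (a ∧ b) ≤ 𝟙 a
  𝟙-∧-≤ true  b = 𝟙≤1 b
  𝟙-∧-≤ false b = z≤n

  𝟙*𝟙≤𝟙ʳ : ∀ a b → 𝟙 a * 𝟙 b ≤ 𝟙 b
  𝟙*𝟙≤𝟙ʳ true  b = ≤-reflexive (+-identityʳ (𝟙 b))
  𝟙*𝟙≤𝟙ʳ false b = z≤n

  𝟙-not : ∀ a → 𝟙 (not a) + 𝟙 a ≡ 1
  𝟙-not true  = refl
  𝟙-not false = refl

  𝟙-∨ : ∀ a b → 𝟙 (a ∨ b) ≡ 𝟙 a + 𝟙 (not a ∧ b)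
  𝟙-∨ true  b     = refl
  𝟙-∨ false true  = refl
  𝟙-∨ false false = refl

  𝟙-split : ∀ a b → 𝟙 a ≡ 𝟙 (a ∧ b) + 𝟙 (a ∧ not b)
  𝟙-split true  true  = refl
  𝟙-split true  false = refl
  𝟙-split false b     = refl

  𝟙-not-* : ∀ a b → 𝟙 (not a) * 𝟙 b + 𝟙 a * 𝟙 b ≡ 𝟙 b
  𝟙-not-* a b = trans (sym (*-distribʳ-+ (𝟙 b) (𝟙 (not a)) (𝟙 a))) (trans (cong (_* 𝟙 b) (𝟙-not a)) (*-identityˡ (𝟙 b)))

  𝟙+𝟙≤𝟙*𝟙+1 : ∀ a b → 𝟙 a + 𝟙 b ≤ 𝟙 a * 𝟙 b + 1
  𝟙+𝟙≤𝟙*𝟙+1 true  true  = ≤-refl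
  𝟙+𝟙≤𝟙*𝟙+1 true  false = ≤-refl
  𝟙+𝟙≤𝟙*𝟙+1 false true  = ≤-refl
  𝟙+𝟙≤𝟙*𝟙+1 false false = z≤n

  𝟙-≡ᵇ-refl : ∀ n → 𝟙 (n ≡ᵇ n) ≡ 1
  𝟙-≡ᵇ-refl zero    = refl
  𝟙-≡ᵇ-refl (suc n) = 𝟙-≡ᵇ-refl n

  𝟙-∧ : ∀ a b → 𝟙 (a ∧ b) ≡ 𝟙 a * 𝟙 b
  𝟙-∧ true  b = sym (+-identityʳ (𝟙 b))
  𝟙-∧ false b = refl

module Ceilings where

  open import Data.Nat
  open import Data.Nat.Properties
  open import Data.Nat.DivMod
  open import Data.Nat.Tactic.RingSolver using (solve-∀; solve)
  open import Data.List using ([]; _∷_)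
  open import Data.Product using (∃; _×_; _,_)
  open import Relation.Binary.PropositionalEquality

  ∃-ceiling : ∀ x D → 0 < D → ∃ λ t → x ≤ D * t × D * t < x + D
  ∃-ceiling x D@(suc _) _ with x % D | m≡m%n+[m/n]*n x D | m%n<n x D
  ... | zero  | x≡q*D | _ = x / D , ≤-reflexive x≡D*q , subst (_< x + D) x≡D*q (m<m+n x z<s)
    where
    x≡D*q : x ≡ D * (x / D)
    x≡D*q = trans x≡q*D (*-comm (x / D) D)
  ... | suc r | x≡1+r+q*D | 1+r<D = suc q , x≤D+q*D , D*[1+q]<x+D
    where
    q = x / D
    x≤D+q*D : x ≤ D * suc q
    x≤D+q*D = begin
      x               ≡⟨ x≡1+r+q*D ⟩
      suc r + q * D   ≤⟨ +-monoˡ-≤ (q * D) (<⇒≤ 1+r<D) ⟩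
      D + q * D       ≡⟨ expand D q ⟩
      D * suc q       ∎
      where
      open ≤-Reasoning
      expand : ∀ D q → D + q * D ≡ D * suc q
      expand = solve-∀
    D*[1+q]<x+D : D * suc q < x + D
    D*[1+q]<x+D = begin-strict
      D * suc q               <⟨ m<m+n (D * suc q) z<s ⟩
      D * suc q + suc r       ≡⟨ rearrange D q r ⟩
      suc r + q * D + D       ≡⟨ cong (_+ D) x≡1+r+q*D ⟨
      x + D                   ∎
      where
      open ≤-Reasoning
      rearrange : ∀ D q r → D * suc q + suc r ≡ suc r + q * D + D
      rearrange = solve-∀

  ceiling-minimal : ∀ {x D t u} → D * t < x + D → x ≤ D * u → t ≤ u
  ceiling-minimal {x} {D} {t} {u} Dt<x+D x≤Du = ≤-pred (*-cancelˡ-< D t (suc u) (begin-strict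
    D * t      <⟨ Dt<x+D ⟩
    x + D      ≤⟨ +-monoˡ-≤ D x≤Du ⟩
    D * u + D  ≡⟨ +-comm (D * u) D ⟩
    D + D * u  ≡⟨ *-suc D u ⟨
    D * suc u  ∎))
    where open ≤-Reasoning

  -- Multiplied by D this reads D²sN + (Dt)² ≤ 3(Dt)(mN), which follows from D²s < m²N + D² and Dt = mN + ρ, ρ < D ≤ mN.
  ceiling-error : ∀ m N D t s → 0 < D → D * D + m * D ≤ m * m * N → m ≤ D → m * N ≤ D * t → D * t < m * N + D →
                  D * D * s < m * m * N + D * D → D * s * N + D * t * t ≤ t * (3 * m * N)
  ceiling-error m N D t s D>0 DD+mD≤mmN m≤D mN≤Dt Dt<mN+D DDs<mmN+DD = *-cancelˡ-≤ D {{>-nonZero D>0}} (begin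
    D * (D * s * N + D * t * t)                              ≡⟨ solve (D ∷ s ∷ N ∷ t ∷ []) ⟩
    D * D * s * N + D * t * (D * t)                          ≤⟨ +-mono-≤ (*-monoˡ-≤ N (<⇒≤ DDs<mmN+DD))
                                                                         (*-monoʳ-≤ (D * t) (<⇒≤ Dt<mN+D)) ⟩
    (m * m * N + D * D) * N + D * t * (m * N + D)            ≡⟨ cong (λ T → (m * m * N + D * D) * N + T * (m * N + D)) Dt≡mN+ρ ⟩
    (m * m * N + D * D) * N + (m * N + ρ) * (m * N + D)      ≡⟨ expand m N D ρ ⟩
    2 * (m * m * N * N) + ρ * (m * N) + ((D * D + m * D) * N + ρ * D)
                                                             ≤⟨ +-monoʳ-≤ (2 * (m * m * N * N) + ρ * (m * N))
                                                                  (+-mono-≤ (*-monoˡ-≤ N DD+mD≤mmN) (*-monoʳ-≤ ρ D≤mN)) ⟩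
    2 * (m * m * N * N) + ρ * (m * N) + (m * m * N * N + ρ * (m * N))
                                                             ≤⟨ +-monoʳ-≤ (2 * (m * m * N * N) + ρ * (m * N))
                                                                  (+-monoʳ-≤ (m * m * N * N) (m≤n+m (ρ * (m * N)) (ρ * (m * N)))) ⟩
    2 * (m * m * N * N) + ρ * (m * N) + (m * m * N * N + (ρ * (m * N) + ρ * (m * N)))
                                                             ≡⟨ collect m N ρ ⟩
    (m * N + ρ) * (3 * m * N)                                ≡⟨ cong (_* (3 * m * N)) Dt≡mN+ρ ⟨
    D * t * (3 * m * N)                                      ≡⟨ *-assoc D t (3 * m * N) ⟩
    D * (t * (3 * m * N))                                    ∎)
    where
    open ≤-Reasoning
    ρ = D * t ∸ m * N
    Dt≡mN+ρ : D * t ≡ m * N + ρ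
    Dt≡mN+ρ = sym (m+[n∸m]≡n mN≤Dt)
    D≤mN : D ≤ m * N
    D≤mN = *-cancelˡ-≤ D {{>-nonZero D>0}} (begin
      D * D          ≤⟨ m≤m+n (D * D) (m * D) ⟩
      D * D + m * D  ≤⟨ DD+mD≤mmN ⟩
      m * m * N      ≡⟨ *-assoc m m N ⟩
      m * (m * N)    ≤⟨ *-monoˡ-≤ (m * N) m≤D ⟩
      D * (m * N)    ∎)
    expand : ∀ m N D ρ → (m * m * N + D * D) * N + (m * N + ρ) * (m * N + D)
                       ≡ 2 * (m * m * N * N) + ρ * (m * N) + ((D * D + m * D) * N + ρ * D)
    expand = solve-∀
    collect : ∀ m N ρ → 2 * (m * m * N * N) + ρ * (m * N) + (m * m * N * N + (ρ * (m * N) + ρ * (m * N)))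
                      ≡ (m * N + ρ) * (3 * m * N)
    collect = solve-∀

  -- With t ≈ mN/D and s ≈ m²N/D², Pollard's bound t(a + b) ≤ tY + sN + t² becomes a + b ≤ Y + 3(m/D)N.
  pollard-rescaled : ∀ m N D t s a b Y → 0 < D → 0 < t → D * D + m * D ≤ m * m * N → m ≤ D →
                     m * N ≤ D * t → D * t < m * N + D → D * D * s < m * m * N + D * D →
                     t * (a + b) ≤ t * Y + s * N + t * t → D * (a + b) ≤ D * Y + 3 * m * N
  pollard-rescaled m N D t s a b Y D>0 t>0 DD+mD≤mmN m≤D mN≤Dt Dt<mN+D DDs<mmN+DD pollard =
    *-cancelˡ-≤ t {{>-nonZero t>0}} (begin
      t * (D * (a + b))                     ≡⟨ solve (t ∷ D ∷ a ∷ b ∷ []) ⟩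
      D * (t * (a + b))                     ≤⟨ *-monoʳ-≤ D pollard ⟩
      D * (t * Y + s * N + t * t)           ≡⟨ solve (D ∷ t ∷ Y ∷ s ∷ N ∷ []) ⟩
      t * (D * Y) + (D * s * N + D * t * t) ≤⟨ +-monoʳ-≤ (t * (D * Y))
                                                (ceiling-error m N D t s D>0 DD+mD≤mmN m≤D mN≤Dt Dt<mN+D DDs<mmN+DD) ⟩
      t * (D * Y) + t * (3 * m * N)         ≡⟨ *-distribˡ-+ t (D * Y) (3 * m * N) ⟨
      t * (D * Y + 3 * m * N)               ∎)
    where open ≤-Reasoning

module RationalEmbedding where

  open import Data.Nat as ℕ using (ℕ; zero; suc)
  import Data.Nat.Properties as ℕ
  open import Data.Nat.Divisibility using (_∣_; divides)
  import Data.Integer as ℤ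
  import Data.Integer.Properties as ℤ
  import Data.Integer.Tactic.RingSolver as ℤ-Solver
  open import Data.Rational
  open import Data.Rational.Properties
  open import Data.Rational.Unnormalised as ℚᵘ using (mkℚᵘ; *≡*)
  import Data.Rational.Unnormalised.Properties as ℚᵘ
  open import Data.Rational.Solver using (module +-*-Solver)
  open import Data.Fin using (Fin) renaming (zero to fzero; suc to fsuc)
  open import Data.List using (foldr; tabulate)
  open import Data.Nat.ListAction using (sum)
  open import Function using (_∘_)
  open import Data.Product using (∃; _,_)
  open import Relation.Binary.PropositionalEquality
  open import Relation.Nullary using (contradiction)

  private
    module ℚ-Solver = Data.Rational.Solver.+-*-Solver

  -- ℕtoℚ n = (+ n) / 1 is definitionally fromℚᵘ (mkℚᵘ (+ n) 0), so its arithmetic is computed in ℚᵘ.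
  toℚᵘ-ℕtoℚ : ∀ m → toℚᵘ (ℕtoℚ m) ℚᵘ.≃ mkℚᵘ (ℤ.+ m) 0
  toℚᵘ-ℕtoℚ m = toℚᵘ-fromℚᵘ (mkℚᵘ (ℤ.+ m) 0)

  ℕtoℚ-suc : ∀ m → ℕtoℚ (suc m) ≡ 1ℚ + ℕtoℚ m
  ℕtoℚ-suc m = toℚᵘ-injective (begin-≃
    toℚᵘ (ℕtoℚ (suc m))                    ≈⟨ toℚᵘ-ℕtoℚ (suc m) ⟩
    mkℚᵘ (ℤ.+ suc m) 0                     ≈⟨ *≡* (trans (cong (ℤ._* ℤ.1ℤ) (ℤ.pos-+ 1 m)) (sym (cross-multiplied (ℤ.+ m)))) ⟩
    mkℚᵘ ℤ.1ℤ 0 ℚᵘ.+ mkℚᵘ (ℤ.+ m) 0         ≈⟨ ℚᵘ.+-cong (toℚᵘ-ℕtoℚ 1) (toℚᵘ-ℕtoℚ m) ⟨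
    toℚᵘ 1ℚ ℚᵘ.+ toℚᵘ (ℕtoℚ m)              ≈⟨ toℚᵘ-homo-+ 1ℚ (ℕtoℚ m) ⟨
    toℚᵘ (1ℚ + ℕtoℚ m)                     ∎-≃)
    where
    open import Relation.Binary.Reasoning.Setoid ℚᵘ.≃-setoid renaming (begin_ to begin-≃_; _∎ to _∎-≃)
    cross-multiplied : ∀ x → (ℤ.1ℤ ℤ.* ℤ.1ℤ ℤ.+ x ℤ.* ℤ.1ℤ) ℤ.* ℤ.1ℤ ≡ (ℤ.1ℤ ℤ.+ x) ℤ.* ℤ.1ℤ
    cross-multiplied = ℤ-Solver.solve-∀

  ℕtoℚ-+ : ∀ a b → ℕtoℚ (a ℕ.+ b) ≡ ℕtoℚ a + ℕtoℚ b
  ℕtoℚ-+ zero    b = sym (+-identityˡ (ℕtoℚ b))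
  ℕtoℚ-+ (suc a) b = begin
    ℕtoℚ (suc (a ℕ.+ b))         ≡⟨ ℕtoℚ-suc (a ℕ.+ b) ⟩
    1ℚ + ℕtoℚ (a ℕ.+ b)          ≡⟨ cong (1ℚ +_) (ℕtoℚ-+ a b) ⟩
    1ℚ + (ℕtoℚ a + ℕtoℚ b)       ≡⟨ +-assoc 1ℚ (ℕtoℚ a) (ℕtoℚ b) ⟨
    1ℚ + ℕtoℚ a + ℕtoℚ b         ≡⟨ cong (_+ ℕtoℚ b) (ℕtoℚ-suc a) ⟨
    ℕtoℚ (suc a) + ℕtoℚ b        ∎
    where open ≡-Reasoning

  ℕtoℚ-* : ∀ a b → ℕtoℚ (a ℕ.* b) ≡ ℕtoℚ a * ℕtoℚ b
  ℕtoℚ-* zero    b = sym (*-zeroˡ (ℕtoℚ b))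
  ℕtoℚ-* (suc a) b = begin
    ℕtoℚ (b ℕ.+ a ℕ.* b)         ≡⟨ ℕtoℚ-+ b (a ℕ.* b) ⟩
    ℕtoℚ b + ℕtoℚ (a ℕ.* b)      ≡⟨ cong (ℕtoℚ b +_) (ℕtoℚ-* a b) ⟩
    ℕtoℚ b + ℕtoℚ a * ℕtoℚ b     ≡⟨ factor (ℕtoℚ a) (ℕtoℚ b) ⟩
    (1ℚ + ℕtoℚ a) * ℕtoℚ b       ≡⟨ cong (_* ℕtoℚ b) (ℕtoℚ-suc a) ⟨
    ℕtoℚ (suc a) * ℕtoℚ b        ∎
    where
    open ≡-Reasoning
    open ℚ-Solver
    factor : ∀ x y → y + x * y ≡ (1ℚ + x) * y
    factor = solve 2 (λ x y → y :+ x :* y := (con 1ℚ :+ x) :* y) refl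

  ℕtoℚ-^ : ∀ a e → ℕtoℚ (a ℕ.^ e) ≡ ℕtoℚ a ^ℚ e
  ℕtoℚ-^ a zero    = refl
  ℕtoℚ-^ a (suc e) = trans (ℕtoℚ-* a (a ℕ.^ e)) (cong (ℕtoℚ a *_) (ℕtoℚ-^ a e))

  ℕtoℚ-nonNeg : ∀ a → NonNegative (ℕtoℚ a)
  ℕtoℚ-nonNeg a = normalize-nonNeg a 1

  ℕtoℚ-pos : ∀ a → Positive (ℕtoℚ (suc a))
  ℕtoℚ-pos a = normalize-pos (suc a) 1

  0≤ℕtoℚ : ∀ a → 0ℚ ≤ ℕtoℚ a
  0≤ℕtoℚ a = nonNegative⁻¹ (ℕtoℚ a) {{ℕtoℚ-nonNeg a}}

  ℕtoℚ-mono-≤ : ∀ {a b} → a ℕ.≤ b → ℕtoℚ a ≤ ℕtoℚ b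
  ℕtoℚ-mono-≤ {a} {b} a≤b = begin
    ℕtoℚ a                      ≡⟨ +-identityʳ (ℕtoℚ a) ⟨
    ℕtoℚ a + 0ℚ                 ≤⟨ +-monoʳ-≤ (ℕtoℚ a) (0≤ℕtoℚ (b ℕ.∸ a)) ⟩
    ℕtoℚ a + ℕtoℚ (b ℕ.∸ a)     ≡⟨ ℕtoℚ-+ a (b ℕ.∸ a) ⟨
    ℕtoℚ (a ℕ.+ (b ℕ.∸ a))      ≡⟨ cong ℕtoℚ (ℕ.m+[n∸m]≡n a≤b) ⟩
    ℕtoℚ b                      ∎
    where open ≤-Reasoning

  ℕtoℚ-mono-< : ∀ {a b} → a ℕ.< b → ℕtoℚ a < ℕtoℚ b
  ℕtoℚ-mono-< {a} {suc b} (ℕ.s≤s a≤b) = begin-strict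
    ℕtoℚ a          ≤⟨ ℕtoℚ-mono-≤ a≤b ⟩
    ℕtoℚ b          ≡⟨ +-identityˡ (ℕtoℚ b) ⟨
    0ℚ + ℕtoℚ b     <⟨ +-monoˡ-< (ℕtoℚ b) (positive⁻¹ 1ℚ) ⟩
    1ℚ + ℕtoℚ b     ≡⟨ ℕtoℚ-suc b ⟨
    ℕtoℚ (suc b)    ∎
    where open ≤-Reasoning

  ℕtoℚ-cancel-≤ : ∀ {a b} → ℕtoℚ a ≤ ℕtoℚ b → a ℕ.≤ b
  ℕtoℚ-cancel-≤ a≤b = ℕ.≮⇒≥ λ b<a → <-irrefl refl (<-≤-trans (ℕtoℚ-mono-< b<a) a≤b)

  ℕtoℚ-cancel-< : ∀ {a b} → ℕtoℚ a < ℕtoℚ b → a ℕ.< b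
  ℕtoℚ-cancel-< a<b = ℕ.≰⇒> λ b≤a → <-irrefl refl (<-≤-trans a<b (ℕtoℚ-mono-≤ b≤a))

  ↧ₙ-integral : ∀ q → 0ℚ ≤ q → ∃ λ p → q * ℕtoℚ (↧ₙ q) ≡ ℕtoℚ p
  ↧ₙ-integral q@(mkℚ (ℤ.+ p) d-1 _) _ = p , toℚᵘ-injective (begin-≃
    toℚᵘ (q * ℕtoℚ (suc d-1))              ≈⟨ toℚᵘ-homo-* q (ℕtoℚ (suc d-1)) ⟩
    toℚᵘ q ℚᵘ.* toℚᵘ (ℕtoℚ (suc d-1))      ≈⟨ ℚᵘ.*-cong (ℚᵘ.≃-refl {toℚᵘ q}) (toℚᵘ-ℕtoℚ (suc d-1)) ⟩
    toℚᵘ q ℚᵘ.* mkℚᵘ (ℤ.+ (suc d-1)) 0     ≈⟨ *≡* (trans (ℤ.*-identityʳ _)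
                                                (cong (λ z → ℤ.+ p ℤ.* ℤ.+ suc z) (sym (ℕ.*-identityʳ d-1)))) ⟩
    mkℚᵘ (ℤ.+ p) 0                         ≈⟨ toℚᵘ-ℕtoℚ p ⟨
    toℚᵘ (ℕtoℚ p)                          ∎-≃)
    where open import Relation.Binary.Reasoning.Setoid ℚᵘ.≃-setoid renaming (begin_ to begin-≃_; _∎ to _∎-≃)
  ↧ₙ-integral (mkℚ ℤ.-[1+ _ ] _ _) 0≤q = contradiction (nonNegative 0≤q) λ ()

  ∣⇒integral : ∀ q D → 0ℚ ≤ q → ↧ₙ q ∣ D → ∃ λ m → q * ℕtoℚ D ≡ ℕtoℚ m
  ∣⇒integral q D 0≤q (divides k refl) with ↧ₙ-integral q 0≤q
  ... | p , q↧≡p = p ℕ.* k , (begin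
    q * ℕtoℚ (k ℕ.* ↧ₙ q)           ≡⟨ cong (q *_) (trans (ℕtoℚ-* k (↧ₙ q)) (*-comm (ℕtoℚ k) (ℕtoℚ (↧ₙ q)))) ⟩
    q * (ℕtoℚ (↧ₙ q) * ℕtoℚ k)      ≡⟨ *-assoc q _ (ℕtoℚ k) ⟨
    q * ℕtoℚ (↧ₙ q) * ℕtoℚ k        ≡⟨ cong (_* ℕtoℚ k) q↧≡p ⟩
    ℕtoℚ p * ℕtoℚ k                 ≡⟨ ℕtoℚ-* p k ⟨
    ℕtoℚ (p ℕ.* k)                  ∎)
    where open ≡-Reasoning

  module _ {p q : ℚ} {a b : ℕ} (D : ℕ) (pD≡a : p * ℕtoℚ D ≡ ℕtoℚ a) (qD≡b : q * ℕtoℚ D ≡ ℕtoℚ b) where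

    ≤⇒cleared-≤ : p ≤ q → a ℕ.≤ b
    ≤⇒cleared-≤ p≤q = ℕtoℚ-cancel-≤ (subst₂ _≤_ pD≡a qD≡b (*-monoʳ-≤-nonNeg (ℕtoℚ D) {{ℕtoℚ-nonNeg D}} p≤q))

    <⇒cleared-< : 0 ℕ.< D → p < q → a ℕ.< b
    <⇒cleared-< (ℕ.s≤s {n = D-1} _) p<q =
      ℕtoℚ-cancel-< (subst₂ _<_ pD≡a qD≡b (*-monoˡ-<-pos (ℕtoℚ D) {{ℕtoℚ-pos D-1}} p<q))

    cleared-≤⇒≤ : 0 ℕ.< D → a ℕ.≤ b → p ≤ q
    cleared-≤⇒≤ (ℕ.s≤s {n = D-1} _) a≤b =
      *-cancelʳ-≤-pos (ℕtoℚ D) {{ℕtoℚ-pos D-1}} (subst₂ _≤_ (sym pD≡a) (sym qD≡b) (ℕtoℚ-mono-≤ a≤b))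

  inv3k-5*[3k-5] : ∀ j → inv3k-5 (suc (suc j)) * ℕtoℚ (suc (3 ℕ.* j)) ≡ 1ℚ
  inv3k-5*[3k-5] j = toℚᵘ-injective (begin-≃
    toℚᵘ (inv3k-5 (suc (suc j)) * ℕtoℚ c)                 ≈⟨ toℚᵘ-homo-* (inv3k-5 (suc (suc j))) (ℕtoℚ c) ⟩
    toℚᵘ (inv3k-5 (suc (suc j))) ℚᵘ.* toℚᵘ (ℕtoℚ c)       ≈⟨ ℚᵘ.*-cong (toℚᵘ-fromℚᵘ (mkℚᵘ ℤ.1ℤ (3 ℕ.* j)))
                                                                         (toℚᵘ-ℕtoℚ c) ⟩
    mkℚᵘ ℤ.1ℤ (3 ℕ.* j) ℚᵘ.* mkℚᵘ (ℤ.+ c) 0               ≈⟨ *≡* cross-multiplied ⟩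
    mkℚᵘ ℤ.1ℤ 0                                           ≈⟨ toℚᵘ-ℕtoℚ 1 ⟨
    toℚᵘ 1ℚ                                               ∎-≃)
    where
    open import Relation.Binary.Reasoning.Setoid ℚᵘ.≃-setoid renaming (begin_ to begin-≃_; _∎ to _∎-≃)
    c = suc (3 ℕ.* j)
    cross-multiplied : ℤ.1ℤ ℤ.* ℤ.+ c ℤ.* ℤ.1ℤ ≡ ℤ.1ℤ ℤ.* ℤ.+ (c ℕ.* 1)
    cross-multiplied = trans (ℤ.*-identityʳ _) (trans (ℤ.*-identityˡ _) (sym (trans (ℤ.*-identityˡ _) (cong ℤ.+_ (ℕ.*-identityʳ c)))))

  0≤inv3k-5 : ∀ j → 0ℚ ≤ inv3k-5 (suc (suc j))
  0≤inv3k-5 j = nonNegative⁻¹ _ {{normalize-nonNeg 1 (suc (3 ℕ.* j))}}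

  ^ℚ-regroup : ∀ j x y d → x ^ℚ suc (j ℕ.+ j) * y ^ℚ suc j * ((d * d) ^ℚ j * d) ≡ ((x * d) * (x * d) * y) ^ℚ j * ((x * d) * y)
  ^ℚ-regroup zero    x y d = rearrange x y d
    where
    open ℚ-Solver
    rearrange : ∀ x y d → x * 1ℚ * (y * 1ℚ) * (1ℚ * d) ≡ 1ℚ * (x * d * y)
    rearrange = solve 3 (λ x y d → x :* con 1ℚ :* (y :* con 1ℚ) :* (con 1ℚ :* d) := con 1ℚ :* (x :* d :* y)) refl
  ^ℚ-regroup (suc j) x y d = begin
    x ^ℚ suc (suc j ℕ.+ suc j) * y ^ℚ suc (suc j) * ((d * d) ^ℚ suc j * d)
      ≡⟨ cong (λ e → x * (x * x ^ℚ e) * y ^ℚ suc (suc j) * ((d * d) ^ℚ suc j * d)) (ℕ.+-suc j j) ⟩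
    x * (x * x ^ℚ suc (j ℕ.+ j)) * (y * y ^ℚ suc j) * (d * d * (d * d) ^ℚ j * d)
      ≡⟨ rearrange x y d (x ^ℚ suc (j ℕ.+ j)) (y ^ℚ suc j) ((d * d) ^ℚ j) ⟩
    (x * d) * (x * d) * y * (x ^ℚ suc (j ℕ.+ j) * y ^ℚ suc j * ((d * d) ^ℚ j * d))
      ≡⟨ cong ((x * d) * (x * d) * y *_) (^ℚ-regroup j x y d) ⟩
    (x * d) * (x * d) * y * (((x * d) * (x * d) * y) ^ℚ j * ((x * d) * y))
      ≡⟨ *-assoc ((x * d) * (x * d) * y) _ _ ⟨
    ((x * d) * (x * d) * y) ^ℚ suc j * ((x * d) * y) ∎
    where
    open ≡-Reasoning
    open ℚ-Solver
    rearrange : ∀ x y d X Y E → x * (x * X) * (y * Y) * (d * d * E * d) ≡ (x * d) * (x * d) * y * (X * Y * (E * d))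
    rearrange = solve 6 (λ x y d X Y E → x :* (x :* X) :* (y :* Y) :* (d :* d :* E :* d)
                                      := (x :* d) :* (x :* d) :* y :* (X :* Y :* (E :* d))) refl

  foldr-⊓-≤-init : ∀ {k} b (f : Fin k → ℚ) → foldr _⊓_ b (tabulate f) ≤ b
  foldr-⊓-≤-init {zero}  b f = ≤-refl
  foldr-⊓-≤-init {suc k} b f = ≤-trans (p⊓q≤q (f fzero) _) (foldr-⊓-≤-init b (f ∘ fsuc))

  foldr-⊓-≤ : ∀ {k} b (f : Fin k → ℚ) i → foldr _⊓_ b (tabulate f) ≤ f i
  foldr-⊓-≤ b f fzero    = p⊓q≤p (f fzero) _
  foldr-⊓-≤ b f (fsuc i) = ≤-trans (p⊓q≤q (f fzero) _) (foldr-⊓-≤ b (f ∘ fsuc) i)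

  ≤-foldr-⊓ : ∀ {k c} b (f : Fin k → ℚ) → c ≤ b → (∀ i → c ≤ f i) → c ≤ foldr _⊓_ b (tabulate f)
  ≤-foldr-⊓ {zero}  b f c≤b c≤f = c≤b
  ≤-foldr-⊓ {suc k} b f c≤b c≤f = ⊓-glb (c≤f fzero) (≤-foldr-⊓ b (f ∘ fsuc) c≤b (c≤f ∘ fsuc))

  foldr-+-scaled : ∀ {k} D (f : Fin k → ℚ) (g : Fin k → ℕ) → (∀ i → f i * ℕtoℚ D ≡ ℕtoℚ (g i)) →
                   foldr _+_ 0ℚ (tabulate f) * ℕtoℚ D ≡ ℕtoℚ (sum (tabulate g))
  foldr-+-scaled {zero}  D f g fD≡g = *-zeroˡ (ℕtoℚ D)
  foldr-+-scaled {suc k} D f g fD≡g = begin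
    (f fzero + foldr _+_ 0ℚ (tabulate (f ∘ fsuc))) * ℕtoℚ D
      ≡⟨ *-distribʳ-+ (ℕtoℚ D) (f fzero) _ ⟩
    f fzero * ℕtoℚ D + foldr _+_ 0ℚ (tabulate (f ∘ fsuc)) * ℕtoℚ D
      ≡⟨ cong₂ _+_ (fD≡g fzero) (foldr-+-scaled D (f ∘ fsuc) (g ∘ fsuc) (fD≡g ∘ fsuc)) ⟩
    ℕtoℚ (g fzero) + ℕtoℚ (sum (tabulate (g ∘ fsuc)))
      ≡⟨ ℕtoℚ-+ (g fzero) _ ⟨
    ℕtoℚ (sum (tabulate g))
      ∎
    where open ≡-Reasoning

  cleared-≤⇒≤ℕtoℚ : ∀ {p a b} D → p * ℕtoℚ D ≡ ℕtoℚ a → 0 ℕ.< D → a ℕ.≤ D ℕ.* b → p ≤ ℕtoℚ b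
  cleared-≤⇒≤ℕtoℚ {b = b} D pD≡a = cleared-≤⇒≤ D pD≡a (trans (*-comm (ℕtoℚ b) (ℕtoℚ D)) (sym (ℕtoℚ-* D b)))

module Residues (N-1 : ℕ) where

  open import Data.Nat
  open import Data.Nat.Properties
  open import Data.Nat.DivMod
  open import Data.Nat.Tactic.RingSolver using (solve-∀)
  open import Relation.Binary.Bundles using (Setoid)
  open import Relation.Binary.PropositionalEquality
  open FiniteSums

  N : ℕ
  N = suc N-1

  Periodic : {A : Set} → (ℕ → A) → Set
  Periodic f = ∀ x → f (x + N) ≡ f x

  module _ {A : Set} {f : ℕ → A} (f-per : Periodic f) where

    periodic-+* : ∀ x q → f (x + q * N) ≡ f x
    periodic-+* x zero    = cong f (+-identityʳ x)
    periodic-+* x (suc q) = begin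
      f (x + (N + q * N)) ≡⟨ cong f (trans (cong (x +_) (+-comm N (q * N))) (sym (+-assoc x (q * N) N))) ⟩
      f (x + q * N + N)   ≡⟨ f-per (x + q * N) ⟩
      f (x + q * N)       ≡⟨ periodic-+* x q ⟩
      f x                 ∎
      where open ≡-Reasoning

    periodic-% : ∀ x → f x ≡ f (x % N)
    periodic-% x = trans (cong f (m≡m%n+[m/n]*n x N)) (periodic-+* (x % N) (x / N))

    periodic-+ˡ : ∀ c → Periodic (λ x → f (c + x))
    periodic-+ˡ c x = trans (cong f (sym (+-assoc c x N))) (f-per (c + x))

    periodic-+ʳ : ∀ c → Periodic (λ x → f (x + c))
    periodic-+ʳ c x = trans (cong f (trans (+-assoc x N c) (trans (cong (x +_) (+-comm N c)) (sym (+-assoc x c N)))))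
                            (f-per (x + c))

  infix 4 _≈_
  record _≈_ (u v : ℕ) : Set where
    constructor mk≈
    field un≈ : u % N ≡ v % N
  open _≈_ public

  ≈-refl : ∀ {u} → u ≈ u
  ≈-refl = mk≈ refl

  ≈-sym : ∀ {u v} → u ≈ v → v ≈ u
  ≈-sym (mk≈ e) = mk≈ (sym e)

  ≈-trans : ∀ {u v w} → u ≈ v → v ≈ w → u ≈ w
  ≈-trans (mk≈ e) (mk≈ e′) = mk≈ (trans e e′)

  ≈-reflexive : ∀ {u v} → u ≡ v → u ≈ v
  ≈-reflexive refl = ≈-refl

  ≈-setoid : Setoid _ _
  ≈-setoid = record
    { Carrier = ℕ ; _≈_ = _≈_
    ; isEquivalence = record { refl = ≈-refl ; sym = ≈-sym ; trans = ≈-trans } }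

  module ≈-Reasoning where
    open import Relation.Binary.Reasoning.Setoid ≈-setoid public

  periodic-≈ : {A : Set} {f : ℕ → A} → Periodic f → ∀ {u v} → u ≈ v → f u ≡ f v
  periodic-≈ {f = f} f-per {u} {v} (mk≈ e) = trans (periodic-% f-per u) (trans (cong f e) (sym (periodic-% f-per v)))

  +-cong-≈ : ∀ {u u′ v v′} → u ≈ u′ → v ≈ v′ → u + v ≈ u′ + v′
  +-cong-≈ {u} {u′} {v} {v′} (mk≈ e) (mk≈ e′) =
    mk≈ (trans (%-distribˡ-+ u v N) (trans (cong₂ (λ a b → (a + b) % N) e e′) (sym (%-distribˡ-+ u′ v′ N))))

  *-cong-≈ : ∀ {u u′ v v′} → u ≈ u′ → v ≈ v′ → u * v ≈ u′ * v′
  *-cong-≈ {u} {u′} {v} {v′} (mk≈ e) (mk≈ e′) =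
    mk≈ (trans (%-distribˡ-* u v N) (trans (cong₂ (λ a b → (a * b) % N) e e′) (sym (%-distribˡ-* u′ v′ N))))

  %-≈ : ∀ u → u % N ≈ u
  %-≈ u = mk≈ (m%n%n≡m%n u N)

  N≈0 : N ≈ 0
  N≈0 = mk≈ (n%n≡0 N)

  *N≈0 : ∀ q → q * N ≈ 0
  *N≈0 q = mk≈ (m*n%n≡0 q N)

  +-≈0ʳ : ∀ {w} v → w ≈ 0 → v + w ≈ v
  +-≈0ʳ v w≈0 = ≈-trans (+-cong-≈ (≈-refl {v}) w≈0) (≈-reflexive (+-identityʳ v))

  infix 8 -_
  -_ : ℕ → ℕ
  - x = N ∸ x % N

  -‿< : ∀ {x} → x < N → - x ≡ N ∸ x
  -‿< x<N = cong (N ∸_) (m<n⇒m%n≡m x<N)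

  -‿cong : ∀ {u v} → u ≈ v → - u ≡ - v
  -‿cong (mk≈ e) = cong (N ∸_) e

  -‿periodic : Periodic -_
  -‿periodic x = -‿cong {x + N} {x} (mk≈ ([m+n]%n≡m%n x N))

  +-inverseʳ : ∀ x → x + - x ≈ 0
  +-inverseʳ x = ≈-trans (+-cong-≈ (≈-sym (%-≈ x)) (≈-refl { - x}))
                         (≈-trans (≈-reflexive (m+[n∸m]≡n (<⇒≤ (m%n<n x N)))) N≈0)

  +-inverseˡ : ∀ x → - x + x ≈ 0
  +-inverseˡ x = ≈-trans (≈-reflexive (+-comm (- x) x)) (+-inverseʳ x)

  +-cancelʳ-≈ : ∀ {u v} c → u + c ≈ v + c → u ≈ v
  +-cancelʳ-≈ {u} {v} c u+c≈v+c = begin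
    u               ≈⟨ +-≈0ʳ u (+-inverseʳ c) ⟨
    u + (c + - c)   ≡⟨ +-assoc u c (- c) ⟨
    u + c + - c     ≈⟨ +-cong-≈ u+c≈v+c ≈-refl ⟩
    v + c + - c     ≡⟨ +-assoc v c (- c) ⟩
    v + (c + - c)   ≈⟨ +-≈0ʳ v (+-inverseʳ c) ⟩
    v               ∎
    where open ≈-Reasoning

  a≢b⇒[a-b]%N>0 : ∀ {a b} → a < N → b < N → a ≢ b → 0 < (a + - b) % N
  a≢b⇒[a-b]%N>0 {a} {b} a<N b<N a≢b = n≢0⇒n>0 λ [a-b]%N≡0 → a≢b (begin
    a       ≡⟨ m<n⇒m%n≡m a<N ⟨
    a % N   ≡⟨ un≈ (+-cancelʳ-≈ {a} {b} (- b) (≈-trans (mk≈ {a + - b} {0} [a-b]%N≡0) (≈-sym (+-inverseʳ b)))) ⟩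
    b % N   ≡⟨ m<n⇒m%n≡m b<N ⟩
    b       ∎)
    where open ≡-Reasoning

  ∑-periodic-suc : ∀ {f : ℕ → ℕ} → Periodic f → ∑[ x < N ] f (suc x) ≡ ∑ N f
  ∑-periodic-suc {f} f-per = +-cancelʳ-≡ (f 0) _ _ (begin
    ∑[ x < N ] f (suc x) + f 0 ≡⟨ +-comm _ (f 0) ⟩
    ∑ (suc N) f               ≡⟨ ∑-init-last N f ⟩
    ∑ N f + f N               ≡⟨ cong (∑ N f +_) (f-per 0) ⟩
    ∑ N f + f 0               ∎)
    where open ≡-Reasoning

  module _ {f : ℕ → ℕ} (f-per : Periodic f) where
    open ≡-Reasoning

    ∑-periodic-shiftʳ : ∀ c → ∑[ x < N ] f (x + c) ≡ ∑ N f
    ∑-periodic-shiftʳ zero    = ∑-cong N (λ x → cong f (+-identityʳ x))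
    ∑-periodic-shiftʳ (suc c) = begin
      ∑[ x < N ] f (x + suc c)   ≡⟨ ∑-cong N (λ x → cong f (+-suc x c)) ⟩
      ∑[ x < N ] f (suc x + c)   ≡⟨ ∑-periodic-suc (periodic-+ʳ f-per c) ⟩
      ∑[ x < N ] f (x + c)       ≡⟨ ∑-periodic-shiftʳ c ⟩
      ∑ N f                      ∎

    ∑-periodic-shiftˡ : ∀ c → ∑[ x < N ] f (c + x) ≡ ∑ N f
    ∑-periodic-shiftˡ c = trans (∑-cong N (λ x → cong f (+-comm c x))) (∑-periodic-shiftʳ c)

    ∑-periodic-reflect : ∀ c → ∑[ x < N ] f (c + - x) ≡ ∑ N f
    ∑-periodic-reflect c = begin
      ∑[ x < N ] f (c + - x)       ≡⟨ ∑-cong-< N (λ x x<N → cong (λ z → f (c + z)) (-‿< x<N)) ⟩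
      ∑[ x < N ] f (c + (N ∸ x))   ≡⟨ ∑-reverse N (λ w → f (c + w)) ⟩
      ∑[ x < N ] f (c + suc x)     ≡⟨ ∑-periodic-suc (periodic-+ˡ f-per c) ⟩
      ∑[ x < N ] f (c + x)         ≡⟨ ∑-periodic-shiftˡ c ⟩
      ∑ N f                        ∎

  reflect-≈ : ∀ x y e → y + - (y + e + - x) ≈ x + - e
  reflect-≈ x y e = +-cancelʳ-≈ c (begin
    y + - c + c               ≡⟨ +-assoc y (- c) c ⟩
    y + (- c + c)             ≈⟨ +-≈0ʳ y (+-inverseˡ c) ⟩
    y                         ≈⟨ +-≈0ʳ y (+-inverseʳ x) ⟨
    y + (x + - x)             ≈⟨ +-≈0ʳ (y + (x + - x)) (+-inverseʳ e) ⟨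
    y + (x + - x) + (e + - e) ≡⟨ rearrange x (- e) y e (- x) ⟩
    x + - e + c               ∎)
    where
    open ≈-Reasoning
    c = y + e + - x
    rearrange : ∀ x ē y e x̄ → y + (x + x̄) + (e + ē) ≡ x + ē + (y + e + x̄)
    rearrange = solve-∀

module Representations (N-1 : ℕ) where

  open import Data.Nat
  open import Data.Nat.Properties
  open import Data.Bool using (Bool; true; false; not; T)
  open import Data.Sum using (inj₁; inj₂)
  open import Function using (_∘_)
  open import Relation.Binary.PropositionalEquality
  open FiniteSums
  open Residues N-1 public

  card : (ℕ → Bool) → ℕ
  card A = ∑[ x < N ] 𝟙 (A x)

  rep : (A B : ℕ → Bool) → ℕ → ℕ
  rep A B y = ∑[ x < N ] (𝟙 (A x) * 𝟙 (B (y + - x)))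

  ∁ : (ℕ → Bool) → (ℕ → Bool)
  ∁ A = not ∘ A

  ∑⊓rep : ℕ → (A B : ℕ → Bool) → ℕ
  ∑⊓rep t A B = ∑[ y < N ] (t ⊓ rep A B y)

  card-full : ∀ {A} → (∀ x → A x ≡ true) → card A ≡ N
  card-full A-full = trans (∑-cong N (cong 𝟙 ∘ A-full)) (∑-one N)

  card-∁ : ∀ A → card (∁ A) + card A ≡ N
  card-∁ A = begin
    card (∁ A) + card A          ≡⟨ ∑-distrib-+ N (𝟙 ∘ ∁ A) (𝟙 ∘ A) ⟨
    ∑[ x < N ] (𝟙 (not (A x)) + 𝟙 (A x)) ≡⟨ ∑-cong N (𝟙-not ∘ A) ⟩
    ∑[ x < N ] 1                 ≡⟨ ∑-one N ⟩
    N                            ∎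
    where open ≡-Reasoning

  module _ {B : ℕ → Bool} (B-per : Periodic B) where

    card-reflect : ∀ y → ∑[ x < N ] 𝟙 (B (y + - x)) ≡ card B
    card-reflect = ∑-periodic-reflect (cong 𝟙 ∘ B-per)

    rep-periodic : ∀ A → Periodic (rep A B)
    rep-periodic A y = ∑-cong N (λ x → cong (λ z → 𝟙 (A x) * 𝟙 z) (periodic-+ʳ B-per (- x) y))

    rep≤card : ∀ A y → rep A B y ≤ card B
    rep≤card A y = begin
      rep A B y                         ≤⟨ ∑-mono-≤ N (λ x _ → 𝟙*𝟙≤𝟙ʳ (A x) (B (y + - x))) ⟩
      ∑[ x < N ] 𝟙 (B (y + - x))        ≡⟨ card-reflect y ⟩
      card B                            ∎
      where open ≤-Reasoning

    card+card≤rep+N : ∀ A y → card A + card B ≤ rep A B y + N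
    card+card≤rep+N A y = begin
      card A + card B                                     ≡⟨ cong (card A +_) (card-reflect y) ⟨
      card A + ∑[ x < N ] 𝟙 (B (y + - x))                 ≡⟨ ∑-distrib-+ N (𝟙 ∘ A) (λ x → 𝟙 (B (y + - x))) ⟨
      ∑[ x < N ] (𝟙 (A x) + 𝟙 (B (y + - x)))             ≤⟨ ∑-mono-≤ N (λ x _ → 𝟙+𝟙≤𝟙*𝟙+1 (A x) (B (y + - x))) ⟩
      ∑[ x < N ] (𝟙 (A x) * 𝟙 (B (y + - x)) + 1)         ≡⟨ ∑-distrib-+ N (λ x → 𝟙 (A x) * 𝟙 (B (y + - x))) (λ _ → 1) ⟩
      rep A B y + ∑[ _ < N ] 1                            ≡⟨ cong (rep A B y +_) (∑-one N) ⟩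
      rep A B y + N                                       ∎
      where open ≤-Reasoning

    ∑-rep : ∀ A → ∑ N (rep A B) ≡ card A * card B
    ∑-rep A = begin
      ∑[ y < N ] ∑[ x < N ] (𝟙 (A x) * 𝟙 (B (y + - x)))
        ≡⟨ ∑-comm N N (λ x y → 𝟙 (A x) * 𝟙 (B (y + - x))) ⟨
      ∑[ x < N ] ∑[ y < N ] (𝟙 (A x) * 𝟙 (B (y + - x)))
        ≡⟨ ∑-cong N (λ x → ∑-distribˡ-* N (𝟙 (A x)) (λ y → 𝟙 (B (y + - x)))) ⟩
      ∑[ x < N ] (𝟙 (A x) * ∑[ y < N ] 𝟙 (B (y + - x)))
        ≡⟨ ∑-cong N (λ x → cong (𝟙 (A x) *_) (∑-periodic-shiftʳ (cong 𝟙 ∘ B-per) (- x))) ⟩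
      ∑[ x < N ] (𝟙 (A x) * card B)
        ≡⟨ ∑-distribʳ-* N (card B) (𝟙 ∘ A) ⟩
      card A * card B
        ∎
      where open ≡-Reasoning

    rep-∁ : ∀ A y → rep (∁ A) B y + rep A B y ≡ card B
    rep-∁ A y = begin
      rep (∁ A) B y + rep A B y
        ≡⟨ ∑-distrib-+ N (λ x → 𝟙 (not (A x)) * 𝟙 (B (y + - x))) (λ x → 𝟙 (A x) * 𝟙 (B (y + - x))) ⟨
      ∑[ x < N ] (𝟙 (not (A x)) * 𝟙 (B (y + - x)) + 𝟙 (A x) * 𝟙 (B (y + - x)))
        ≡⟨ ∑-cong N (λ x → 𝟙-not-* (A x) (B (y + - x))) ⟩
      ∑[ x < N ] 𝟙 (B (y + - x))
        ≡⟨ card-reflect y ⟩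
      card B
        ∎
      where open ≡-Reasoning

    ∑⊓rep-card : ∀ A → ∑⊓rep (card B) A B ≡ card A * card B
    ∑⊓rep-card A = trans (∑-cong N (λ y → m≥n⇒m⊓n≡n (rep≤card A y))) (∑-rep A)

    -- As r_{∁A,B} = |B| − r_{A,B}, min(|B| − t, r_{∁A,B}) = |B| − max(t, r_{A,B}) = |B| − t − r_{A,B} + min(t, r_{A,B}).
    ∑⊓rep-∁ : ∀ A t → t ≤ card B →
              ∑⊓rep (card B ∸ t) (∁ A) B + N * t + card A * card B ≡ N * card B + ∑⊓rep t A B
    ∑⊓rep-∁ A t t≤b = begin
      ∑⊓rep u (∁ A) B + N * t + card A * card B
        ≡⟨ cong₂ (λ p q → ∑⊓rep u (∁ A) B + p + q) (∑-const N t) (∑-rep A) ⟨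
      ∑⊓rep u (∁ A) B + ∑[ _ < N ] t + ∑ N (rep A B)
        ≡⟨ cong (_+ ∑ N (rep A B)) (∑-distrib-+ N (λ y → u ⊓ rep (∁ A) B y) (λ _ → t)) ⟨
      ∑[ y < N ] (u ⊓ rep (∁ A) B y + t) + ∑ N (rep A B)
        ≡⟨ ∑-distrib-+ N (λ y → u ⊓ rep (∁ A) B y + t) (rep A B) ⟨
      ∑[ y < N ] (u ⊓ rep (∁ A) B y + t + rep A B y)
        ≡⟨ ∑-cong N pointwise ⟩
      ∑[ y < N ] (card B + t ⊓ rep A B y)
        ≡⟨ ∑-distrib-+ N (λ _ → card B) (λ y → t ⊓ rep A B y) ⟩
      ∑[ _ < N ] card B + ∑⊓rep t A B
        ≡⟨ cong (_+ ∑⊓rep t A B) (∑-const N (card B)) ⟩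
      N * card B + ∑⊓rep t A B ∎
      where
      open ≡-Reasoning
      u = card B ∸ t
      ⊔+⊓ : ∀ m n → m ⊔ n + m ⊓ n ≡ m + n
      ⊔+⊓ m n with ≤-total m n
      ... | inj₁ m≤n = trans (cong₂ _+_ (m≤n⇒m⊔n≡n m≤n) (m≤n⇒m⊓n≡m m≤n)) (+-comm n m)
      ... | inj₂ n≤m = cong₂ _+_ (m≥n⇒m⊔n≡m n≤m) (m≥n⇒m⊓n≡n n≤m)
      pointwise : ∀ y → u ⊓ rep (∁ A) B y + t + rep A B y ≡ card B + t ⊓ rep A B y
      pointwise y = begin
        u ⊓ r̄ + t + r                      ≡⟨ cong (λ z → u ⊓ z + t + r) r̄≡b∸r ⟩
        (b ∸ t) ⊓ (b ∸ r) + t + r          ≡⟨ cong (λ z → z + t + r) (∸-distribˡ-⊔-⊓ b t r) ⟨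
        b ∸ (t ⊔ r) + t + r                ≡⟨ +-assoc (b ∸ (t ⊔ r)) t r ⟩
        b ∸ (t ⊔ r) + (t + r)              ≡⟨ cong (b ∸ (t ⊔ r) +_) (⊔+⊓ t r) ⟨
        b ∸ (t ⊔ r) + (t ⊔ r + t ⊓ r)      ≡⟨ +-assoc (b ∸ (t ⊔ r)) (t ⊔ r) (t ⊓ r) ⟨
        b ∸ (t ⊔ r) + (t ⊔ r) + t ⊓ r      ≡⟨ cong (_+ t ⊓ r) (m∸n+n≡m (⊔-lub t≤b (rep≤card A y))) ⟩
        b + t ⊓ r                          ∎
        where
        b = card B
        r = rep A B y
        r̄ = rep (∁ A) B y
        r̄≡b∸r : r̄ ≡ b ∸ r
        r̄≡b∸r = trans (sym (m+n∸n≡m r̄ r)) (cong (_∸ r) (rep-∁ A y))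

  ∁-periodic : ∀ {A} → Periodic A → Periodic (∁ A)
  ∁-periodic A-per x = cong not (A-per x)

  ∑⊓rep≤threshold : ∀ t s A B → ∑⊓rep t A B ≤ t * card (λ y → s ≤ᵇ rep A B y) + s * N
  ∑⊓rep≤threshold t s A B = begin
    ∑⊓rep t A B                                         ≤⟨ ∑-mono-≤ N (λ y _ → ⊓≤threshold (rep A B y)) ⟩
    ∑[ y < N ] (t * 𝟙 (s ≤ᵇ rep A B y) + s)            ≡⟨ ∑-distrib-+ N (λ y → t * 𝟙 (s ≤ᵇ rep A B y)) (λ _ → s) ⟩
    ∑[ y < N ] (t * 𝟙 (s ≤ᵇ rep A B y)) + ∑[ _ < N ] s ≡⟨ cong₂ _+_ (∑-distribˡ-* N t (λ y → 𝟙 (s ≤ᵇ rep A B y)))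
                                                                    (trans (∑-const N s) (*-comm N s)) ⟩
    t * card (λ y → s ≤ᵇ rep A B y) + s * N             ∎
    where
    open ≤-Reasoning
    ⊓≤threshold : ∀ r → t ⊓ r ≤ t * 𝟙 (s ≤ᵇ r) + s
    ⊓≤threshold r with s ≤ᵇ r in s≤ᵇr
    ... | true  = ≤-trans (m⊓n≤m t r) (≤-trans (≤-reflexive (sym (*-identityʳ t))) (m≤m+n (t * 1) s))
    ... | false = ≤-trans (m⊓n≤n t r) (≤-trans (<⇒≤ (≰⇒> λ s≤r → subst T s≤ᵇr (≤⇒≤ᵇ s≤r))) (m≤n+m s (t * 0)))

module DysonTransform (N-1 : ℕ) where

  open import Data.Nat
  open import Data.Nat.Properties
  open import Data.Nat.Tactic.RingSolver using (solve-∀)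
  open import Data.Bool using (Bool; true; false; not; _∧_; _∨_)
  open import Data.Bool.Properties using (∧-comm)
  open import Function using (_∘_)
  open import Relation.Binary.PropositionalEquality
  open FiniteSums
  open Representations N-1

  -- Dyson's e-transform (A ∪ (B + e), B ∩ (A − e)); dysonC is what A gains and dysonD what B loses.
  dysonA dysonB dysonC dysonD : (A B : ℕ → Bool) → ℕ → ℕ → Bool
  dysonA A B e x = A x ∨ B (x + - e)
  dysonB A B e x = B x ∧ A (x + e)
  dysonC A B e x = not (A x) ∧ B (x + - e)
  dysonD A B e x = B x ∧ not (A (x + e))

  module _ {A B : ℕ → Bool} (A-per : Periodic A) (B-per : Periodic B) (e : ℕ) where

    dysonA-periodic : Periodic (dysonA A B e)
    dysonA-periodic x = cong₂ _∨_ (A-per x) (periodic-+ʳ B-per (- e) x)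

    dysonB-periodic : Periodic (dysonB A B e)
    dysonB-periodic x = cong₂ _∧_ (B-per x) (periodic-+ʳ A-per e x)

    card-dysonA : card (dysonA A B e) ≡ card A + card (dysonC A B e)
    card-dysonA = trans (∑-cong N (λ x → 𝟙-∨ (A x) (B (x + - e))))
                        (∑-distrib-+ N (𝟙 ∘ A) (𝟙 ∘ dysonC A B e))

    card-dysonB : card B ≡ card (dysonB A B e) + card (dysonD A B e)
    card-dysonB = trans (∑-cong N (λ x → 𝟙-split (B x) (A (x + e))))
                        (∑-distrib-+ N (𝟙 ∘ dysonB A B e) (𝟙 ∘ dysonD A B e))

    card-dysonC≡card-dysonD : card (dysonC A B e) ≡ card (dysonD A B e)
    card-dysonC≡card-dysonD = begin
      ∑[ x < N ] 𝟙 (not (A x) ∧ B (x + - e))              ≡⟨ ∑-periodic-shiftʳ C-per e ⟨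
      ∑[ x < N ] 𝟙 (not (A (x + e)) ∧ B (x + e + - e))    ≡⟨ ∑-cong N (λ x → cong 𝟙 (trans (cong (not (A (x + e)) ∧_) (B-shift x))
                                                                                    (∧-comm (not (A (x + e))) (B x)))) ⟩
      ∑[ x < N ] 𝟙 (B x ∧ not (A (x + e)))                ∎
      where
      open ≡-Reasoning
      C-per : Periodic (𝟙 ∘ dysonC A B e)
      C-per x = cong 𝟙 (cong₂ _∧_ (cong not (A-per x)) (periodic-+ʳ B-per (- e) x))
      B-shift : ∀ x → B (x + e + - e) ≡ B x
      B-shift x = periodic-≈ B-per (≈-trans (≈-reflexive (+-assoc x e (- e))) (+-≈0ʳ x (+-inverseʳ e)))

    card-dyson : card (dysonA A B e) + card (dysonB A B e) ≡ card A + card B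
    card-dyson = begin
      card (dysonA A B e) + card (dysonB A B e)  ≡⟨ cong (_+ card (dysonB A B e)) card-dysonA ⟩
      card A + card C + card (dysonB A B e)      ≡⟨ +-assoc (card A) (card C) _ ⟩
      card A + (card C + card (dysonB A B e))    ≡⟨ cong (λ z → card A + (z + card (dysonB A B e))) card-dysonC≡card-dysonD ⟩
      card A + (card D + card (dysonB A B e))    ≡⟨ cong (card A +_) (trans (+-comm (card D) _) (sym card-dysonB)) ⟩
      card A + card B                            ∎
      where
      open ≡-Reasoning
      C = dysonC A B e
      D = dysonD A B e

    rep-dysonA : ∀ y → rep (dysonA A B e) (dysonB A B e) y ≡ rep A (dysonB A B e) y + rep (dysonC A B e) (dysonB A B e) y
    rep-dysonA y = trans (∑-cong N split) (∑-distrib-+ N (λ x → 𝟙 (A x) * B′[y-x] x) (λ x → 𝟙 (dysonC A B e x) * B′[y-x] x))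
      where
      B′[y-x] : ℕ → ℕ
      B′[y-x] x = 𝟙 (dysonB A B e (y + - x))
      split : ∀ x → 𝟙 (dysonA A B e x) * B′[y-x] x ≡ 𝟙 (A x) * B′[y-x] x + 𝟙 (dysonC A B e x) * B′[y-x] x
      split x = trans (cong (_* B′[y-x] x) (𝟙-∨ (A x) (B (x + - e)))) (*-distribʳ-+ (B′[y-x] x) (𝟙 (A x)) _)

    rep-dysonB+rep-dysonD : ∀ y → rep A (dysonB A B e) y + rep A (dysonD A B e) y ≡ rep A B y
    rep-dysonB+rep-dysonD y = trans (sym (∑-distrib-+ N (λ x → 𝟙 (A x) * 𝟙 (dysonB A B e (y + - x)))
                                                         (λ x → 𝟙 (A x) * 𝟙 (dysonD A B e (y + - x)))))
                                    (∑-cong N merge)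
      where
      merge : ∀ x → 𝟙 (A x) * 𝟙 (dysonB A B e (y + - x)) + 𝟙 (A x) * 𝟙 (dysonD A B e (y + - x)) ≡ 𝟙 (A x) * 𝟙 (B (y + - x))
      merge x = trans (sym (*-distribˡ-+ (𝟙 (A x)) (𝟙 (dysonB A B e (y + - x))) (𝟙 (dysonD A B e (y + - x)))))
                      (cong (𝟙 (A x) *_) (sym (𝟙-split (B (y + - x)) (A (y + - x + e)))))

    -- x ↦ y + e − x maps representations of y from dysonC × dysonB injectively to representations from A × dysonD.
    rep-dysonC≤rep-dysonD : ∀ y → rep (dysonC A B e) (dysonB A B e) y ≤ rep A (dysonD A B e) y
    rep-dysonC≤rep-dysonD y = ≤-trans (∑-mono-≤ N (λ x _ → pointwise x)) (≤-reflexive (∑-periodic-reflect AD-per (y + e)))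
      where
      open ≤-Reasoning
      w : ℕ → ℕ
      w x = y + - x
      AD-per : Periodic (λ z → 𝟙 (A z) * 𝟙 (dysonD A B e (w z)))
      AD-per z = cong₂ (λ a b → 𝟙 a * 𝟙 b) (A-per z) (cong (λ u → dysonD A B e (y + u)) (-‿periodic z))
      pointwise : ∀ x → 𝟙 (dysonC A B e x) * 𝟙 (dysonB A B e (w x)) ≤ 𝟙 (A (y + e + - x)) * 𝟙 (dysonD A B e (w (y + e + - x)))
      pointwise x = begin
        𝟙 (not (A x) ∧ B (x + - e)) * 𝟙 (B (w x) ∧ A (w x + e))
          ≤⟨ 𝟙-rearrange (A x) (B (x + - e)) (B (w x)) (A (w x + e)) ⟩
        𝟙 (A (w x + e)) * 𝟙 (B (x + - e) ∧ not (A x))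
          ≡⟨ cong₂ (λ a b → 𝟙 a * 𝟙 b) (cong A (+-comm-middle y (- x) e))
                   (cong₂ (λ b a → b ∧ not a) (periodic-≈ B-per w[z]≈x-e) (periodic-≈ A-per w[z]+e≈x)) ⟨
        𝟙 (A z) * 𝟙 (B (w z) ∧ not (A (w z + e)))
          ∎
        where
        z = y + e + - x
        +-comm-middle : ∀ a b c → a + c + b ≡ a + b + c
        +-comm-middle = solve-∀
        w[z]≈x-e : w z ≈ x + - e
        w[z]≈x-e = reflect-≈ x y e
        w[z]+e≈x : w z + e ≈ x
        w[z]+e≈x = ≈-trans (+-cong-≈ w[z]≈x-e (≈-refl {e}))
                     (≈-trans (≈-reflexive (+-assoc x (- e) e)) (+-≈0ʳ x (+-inverseˡ e)))
        𝟙-rearrange : ∀ a b b′ a′ → 𝟙 (not a ∧ b) * 𝟙 (b′ ∧ a′) ≤ 𝟙 a′ * 𝟙 (b ∧ not a)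
        𝟙-rearrange true  b     b′    a′    = z≤n
        𝟙-rearrange false false b′    a′    = z≤n
        𝟙-rearrange false true  false a′    = z≤n
        𝟙-rearrange false true  true  false = z≤n
        𝟙-rearrange false true  true  true  = ≤-refl

    rep-dyson-≤ : ∀ y → rep (dysonA A B e) (dysonB A B e) y ≤ rep A B y
    rep-dyson-≤ y = begin
      rep (dysonA A B e) (dysonB A B e) y                           ≡⟨ rep-dysonA y ⟩
      rep A (dysonB A B e) y + rep (dysonC A B e) (dysonB A B e) y  ≤⟨ +-monoʳ-≤ (rep A (dysonB A B e) y) (rep-dysonC≤rep-dysonD y) ⟩
      rep A (dysonB A B e) y + rep A (dysonD A B e) y               ≡⟨ rep-dysonB+rep-dysonD y ⟩
      rep A B y                                                     ∎
      where open ≤-Reasoning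

    ∑⊓rep-dyson-≤ : ∀ t → ∑⊓rep t (dysonA A B e) (dysonB A B e) ≤ ∑⊓rep t A B
    ∑⊓rep-dyson-≤ t = ∑-mono-≤ N (λ y _ → ⊓-monoʳ-≤ t (rep-dyson-≤ y))

module DysonShift (N-1 : ℕ) (prime : Prime (suc N-1)) where

  open import Data.Nat
  open import Data.Nat.Properties
  open import Data.Nat.DivMod
  open import Data.Nat.Coprimality using (prime⇒coprime; coprime-Bézout)
  open import Data.Nat.GCD using (module Bézout)
  open import Data.Nat.Tactic.RingSolver using (solve-∀)
  open import Data.Bool using (Bool; true; false; not; _∧_; T)
  open import Data.Fin using (Fin; toℕ; fromℕ<)
  open import Data.Fin.Properties using (any?; toℕ-fromℕ<)
  open import Data.Product using (∃; ∃₂; _×_; _,_; proj₁; proj₂)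
  open import Function using (_∘_)
  open import Relation.Binary.PropositionalEquality
  open import Relation.Nullary using (¬_; Dec; yes; no; contradiction)
  open import Relation.Nullary.Decidable using (_×-dec_)
  open FiniteSums
  open Representations N-1
  open DysonTransform N-1

  ∃-inverse : ∀ d → 0 < d % N → ∃ λ j → j * d ≈ 1
  ∃-inverse d d%N>0 with coprime-Bézout (prime⇒coprime prime {{>-nonZero d%N>0}} (m%n<n d N))
  ... | Bézout.-+ x y eq = y , (begin
    y * d             ≈⟨ *-cong-≈ (≈-refl {y}) (%-≈ d) ⟨
    y * (d % N)       ≡⟨ eq ⟨
    1 + x * N         ≈⟨ +-≈0ʳ 1 (*N≈0 x) ⟩
    1                 ∎)
    where open ≈-Reasoning
  ... | Bézout.+- x y eq = N-1 * y , (begin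
    N-1 * y * d       ≈⟨ *-cong-≈ (≈-refl {N-1 * y}) (%-≈ d) ⟨
    N-1 * y * (d % N) ≡⟨ *-assoc N-1 y (d % N) ⟩
    N-1 * (y * (d % N)) ≈⟨ *-cong-≈ (≈-refl {N-1}) y[d%N]≈N-1 ⟩
    N-1 * N-1         ≈⟨ N-1²≈1 ⟩
    1                 ∎)
    where
    open ≈-Reasoning
    y[d%N]≈N-1 : y * (d % N) ≈ N-1
    y[d%N]≈N-1 = +-cancelʳ-≈ 1 (begin
      y * (d % N) + 1 ≡⟨ +-comm _ 1 ⟩
      1 + y * (d % N) ≡⟨ eq ⟩
      x * N           ≈⟨ *N≈0 x ⟩
      0               ≈⟨ N≈0 ⟨
      1 + N-1         ≡⟨ +-comm 1 N-1 ⟩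
      N-1 + 1         ∎)
    N-1²≈1 : N-1 * N-1 ≈ 1
    N-1²≈1 = +-cancelʳ-≈ N-1 (begin
      N-1 * N-1 + N-1 ≡⟨ square+self N-1 ⟩
      N-1 * N         ≈⟨ *N≈0 N-1 ⟩
      0               ≈⟨ N≈0 ⟨
      1 + N-1         ∎)
      where
      square+self : ∀ n → n * n + n ≡ n * suc n
      square+self = solve-∀

  ∃-element : ∀ A → 0 < card A → ∃ λ x → x < N × A x ≡ true
  ∃-element A |A|>0 with ∑-pos⇒∃-pos N (𝟙 ∘ A) |A|>0
  ... | x , x<N , 𝟙Ax>0 = x , x<N , 𝟙-pos⇒true 𝟙Ax>0

  ∃-two-elements : ∀ B → 2 ≤ card B → ∃₂ λ b₀ b₁ → b₀ < N × b₁ < N × B b₀ ≡ true × B b₁ ≡ true × b₁ ≢ b₀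
  ∃-two-elements B |B|≥2 with ∃-element B (≤-trans (s≤s z≤n) |B|≥2)
  ... | b₀ , b₀<N , Bb₀ with ∃-element B∖b₀ |B∖b₀|>0
    where
    B∖b₀ : ℕ → Bool
    B∖b₀ x = B x ∧ not (x ≡ᵇ b₀)
    ∑-≡ᵇ≤1 : ∀ n c → ∑[ x < n ] 𝟙 (x ≡ᵇ c) ≤ 1
    ∑-≡ᵇ≤1 zero    c       = z≤n
    ∑-≡ᵇ≤1 (suc n) zero    = ≤-reflexive (cong suc (trans (∑-const n 0) (*-zeroʳ n)))
    ∑-≡ᵇ≤1 (suc n) (suc c) = ∑-≡ᵇ≤1 n c
    𝟙≤𝟙∖+𝟙 : ∀ b c → 𝟙 b ≤ 𝟙 (b ∧ not c) + 𝟙 c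
    𝟙≤𝟙∖+𝟙 true  true  = s≤s z≤n
    𝟙≤𝟙∖+𝟙 true  false = s≤s z≤n
    𝟙≤𝟙∖+𝟙 false c     = z≤n
    |B∖b₀|>0 : 0 < card B∖b₀
    |B∖b₀|>0 = ≤-pred (subst (1 <_) (+-comm (card B∖b₀) 1) (begin-strict
      1                                        <⟨ |B|≥2 ⟩
      card B                                   ≤⟨ ∑-mono-≤ N (λ x _ → 𝟙≤𝟙∖+𝟙 (B x) (x ≡ᵇ b₀)) ⟩
      ∑[ x < N ] (𝟙 (B∖b₀ x) + 𝟙 (x ≡ᵇ b₀)) ≡⟨ ∑-distrib-+ N (𝟙 ∘ B∖b₀) (λ x → 𝟙 (x ≡ᵇ b₀)) ⟩
      card B∖b₀ + ∑[ x < N ] 𝟙 (x ≡ᵇ b₀)    ≤⟨ +-monoʳ-≤ (card B∖b₀) (∑-≡ᵇ≤1 N b₀) ⟩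
      card B∖b₀ + 1                            ∎))
      where open ≤-Reasoning
  ... | b₁ , b₁<N , B∖b₀[b₁] with B b₁ in Bb₁ | b₁ ≡ᵇ b₀ in b₁≡ᵇb₀
  ...   | true  | false = b₀ , b₁ , b₀<N , b₁<N , Bb₀ , Bb₁ , λ b₁≡b₀ → subst T b₁≡ᵇb₀ (≡⇒≡ᵇ b₁ b₀ b₁≡b₀)
  ...   | true  | true  = contradiction B∖b₀[b₁] λ ()
  ...   | false | _     = contradiction B∖b₀[b₁] λ ()

  closed⇒full : ∀ {A} → Periodic A → ∀ {x₀ d} → A x₀ ≡ true → 0 < d % N →
                (∀ x → A x ≡ true → A (x + d) ≡ true) → ∀ z → A z ≡ true
  closed⇒full {A} A-per {x₀} {d} Ax₀ d%N>0 step z = trans (periodic-≈ A-per (≈-sym x₀+id≈z)) (iterate i)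
    where
    j = proj₁ (∃-inverse d d%N>0)
    i = (z + - x₀) * j
    iterate : ∀ i → A (x₀ + i * d) ≡ true
    iterate zero    = trans (cong A (+-identityʳ x₀)) Ax₀
    iterate (suc i) = trans (cong A (+-assoc-comm x₀ d (i * d))) (step _ (iterate i))
      where
      +-assoc-comm : ∀ x d id → x + (d + id) ≡ x + id + d
      +-assoc-comm = solve-∀
    x₀+id≈z : x₀ + i * d ≈ z
    x₀+id≈z = begin
      x₀ + (z + - x₀) * j * d     ≡⟨ cong (x₀ +_) (*-assoc (z + - x₀) j d) ⟩
      x₀ + (z + - x₀) * (j * d)   ≈⟨ +-cong-≈ (≈-refl {x₀}) (*-cong-≈ (≈-refl {z + - x₀}) (proj₂ (∃-inverse d d%N>0))) ⟩
      x₀ + (z + - x₀) * 1         ≡⟨ +-comm-*1 x₀ z (- x₀) ⟩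
      z + (x₀ + - x₀)             ≈⟨ +-≈0ʳ z (+-inverseʳ x₀) ⟩
      z                           ∎
      where
      open ≈-Reasoning
      +-comm-*1 : ∀ x z x̄ → x + (z + x̄) * 1 ≡ z + (x + x̄)
      +-comm-*1 = solve-∀

  module _ {A B : ℕ → Bool} (A-per : Periodic A) where

    ProperShift : ℕ → Set
    ProperShift e = 0 < card (dysonB A B e) × card (dysonB A B e) < card B

    card-dysonB≤card : ∀ e → card (dysonB A B e) ≤ card B
    card-dysonB≤card e = ∑-mono-≤ N (λ x _ → 𝟙-∧-≤ (B x) (A (x + e)))

    -- Taking e = x − b₀ puts b₀ in B ∩ (A − e), hence all of B, and in particular b₁ + e = x + (b₁ − b₀) ∈ A.
    no-proper-shift⇒closed : (∀ e → e < N → ¬ ProperShift e) → ∀ {b₀ b₁} → b₀ < N → b₁ < N →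
                             B b₀ ≡ true → B b₁ ≡ true → ∀ x → A x ≡ true → A (x + (b₁ + - b₀)) ≡ true
    no-proper-shift⇒closed ¬proper {b₀} {b₁} b₀<N b₁<N Bb₀ Bb₁ x Ax = trans (periodic-≈ A-per (≈-sym (move b₁))) A[b₁+e]
      where
      e = (x + - b₀) % N
      B′ = dysonB A B e
      move : ∀ b → b + e ≈ x + (b + - b₀)
      move b = ≈-trans (+-cong-≈ (≈-refl {b}) (%-≈ (x + - b₀))) (≈-reflexive (+-comm-middle b x (- b₀)))
        where
        +-comm-middle : ∀ b x b̄ → b + (x + b̄) ≡ x + (b + b̄)
        +-comm-middle = solve-∀
      B′b₀ : B′ b₀ ≡ true
      B′b₀ = cong₂ _∧_ Bb₀ (trans (periodic-≈ A-per (≈-trans (move b₀) (+-≈0ʳ x (+-inverseʳ b₀)))) Ax)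
      |B′|>0 : 0 < card B′
      |B′|>0 = <-≤-trans (subst (λ b → 0 < 𝟙 b) (sym B′b₀) z<s) (term≤∑ N (𝟙 ∘ B′) b₀<N)
      |B′|≡|B| : card B′ ≡ card B
      |B′|≡|B| = ≤-antisym (card-dysonB≤card e) (≮⇒≥ λ |B′|<|B| → ¬proper e (m%n<n (x + - b₀) N) (|B′|>0 , |B′|<|B|))
      𝟙B′b₁≡𝟙Bb₁ : 𝟙 (B b₁ ∧ A (b₁ + e)) ≡ 𝟙 (B b₁)
      𝟙B′b₁≡𝟙Bb₁ = ∑-≤-≡⇒≡ N (λ x _ → 𝟙-∧-≤ (B x) (A (x + e))) |B′|≡|B| b₁ b₁<N
      A[b₁+e] : A (b₁ + e) ≡ true
      A[b₁+e] = 𝟙-pos⇒true (subst (0 <_) (sym (subst (λ b → 𝟙 (b ∧ A (b₁ + e)) ≡ 𝟙 b) Bb₁ 𝟙B′b₁≡𝟙Bb₁)) z<s)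

    -- If no shift is proper, A is invariant under the nonzero shift b₁ − b₀; as N is prime this forces A = ℤ_N.
    ∃-proper-shift : 0 < card A → card A < N → 2 ≤ card B → ∃ ProperShift
    ∃-proper-shift |A|>0 |A|<N |B|≥2 with any? (λ (e : Fin N) → proper? (toℕ e))
      where
      proper? : ∀ e → Dec (ProperShift e)
      proper? e = (0 <? card (dysonB A B e)) ×-dec (card (dysonB A B e) <? card B)
    ... | yes (e , proper) = toℕ e , proper
    ... | no ¬proper with ∃-element A |A|>0 | ∃-two-elements B |B|≥2
    ... | x₀ , _ , Ax₀ | b₀ , b₁ , b₀<N , b₁<N , Bb₀ , Bb₁ , b₁≢b₀ =
      contradiction (card-full (closed⇒full A-per Ax₀ (a≢b⇒[a-b]%N>0 b₁<N b₀<N b₁≢b₀)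
                                  (no-proper-shift⇒closed ¬proper′ b₀<N b₁<N Bb₀ Bb₁)))
                    (<⇒≢ |A|<N)
      where
      ¬proper′ : ∀ e → e < N → ¬ ProperShift e
      ¬proper′ e e<N proper = ¬proper (fromℕ< e<N , subst ProperShift (sym (toℕ-fromℕ< e<N)) proper)

module PollardTheorem (N-1 : ℕ) (prime : Prime (suc N-1)) where

  open import Data.Nat
  open import Data.Nat.Properties
  open import Data.Nat.Tactic.RingSolver using (solve-∀; solve)
  open import Data.List using ([]; _∷_)
  open import Data.Bool using (Bool)
  open import Data.Product using (_,_)
  open import Relation.Binary.PropositionalEquality
  open import Relation.Nullary using (yes; no; contradiction)
  open FiniteSums
  open Representations N-1
  open DysonTransform N-1
  open DysonShift N-1 prime

  PollardBound : ℕ → (A B : ℕ → Bool) → Set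
  PollardBound t A B = t * (card A + card B) ≤ ∑⊓rep t A B + t * t

  dyson-pollardBound : ∀ {A B} → Periodic A → Periodic B → ∀ e t →
                       PollardBound t (dysonA A B e) (dysonB A B e) → PollardBound t A B
  dyson-pollardBound {A} {B} A-per B-per e t bound = begin
    t * (card A + card B)              ≡⟨ cong (t *_) (card-dyson A-per B-per e) ⟨
    t * (card A′ + card B′)            ≤⟨ bound ⟩
    ∑⊓rep t A′ B′ + t * t              ≤⟨ +-monoˡ-≤ (t * t) (∑⊓rep-dyson-≤ A-per B-per e t) ⟩
    ∑⊓rep t A B + t * t                ∎
    where
    open ≤-Reasoning
    A′ = dysonA A B e
    B′ = dysonB A B e

  pollard-duality-arith : ∀ a ā u t X Y → u * (ā + (u + t)) ≤ X + u * u →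
                          X + (ā + a) * t + a * (u + t) ≡ (ā + a) * (u + t) + Y → t * (a + (u + t)) ≤ Y + t * t
  pollard-duality-arith a ā u t X Y bound duality = +-cancelʳ-≤ ((ā + a) * (u + t)) _ _ (begin
    t * (a + (u + t)) + (ā + a) * (u + t)               ≡⟨ solve (a ∷ ā ∷ u ∷ t ∷ []) ⟩
    u * (ā + t) + ((ā + a) * t + a * (u + t) + t * t)   ≤⟨ +-monoˡ-≤ _ u[ā+t]≤X ⟩
    X + ((ā + a) * t + a * (u + t) + t * t)             ≡⟨ solve (a ∷ ā ∷ u ∷ t ∷ X ∷ []) ⟩
    X + (ā + a) * t + a * (u + t) + t * t               ≡⟨ cong (_+ t * t) duality ⟩
    (ā + a) * (u + t) + Y + t * t                       ≡⟨ solve (a ∷ ā ∷ u ∷ t ∷ Y ∷ []) ⟩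
    Y + t * t + (ā + a) * (u + t)                       ∎)
    where
    open ≤-Reasoning
    u[ā+t]≤X : u * (ā + t) ≤ X
    u[ā+t]≤X = +-cancelʳ-≤ (u * u) _ _ (subst (_≤ X + u * u) expand bound)
      where
      expand : u * (ā + (u + t)) ≡ u * (ā + t) + u * u
      expand = solve (ā ∷ u ∷ t ∷ [])

  ∁-pollardBound : ∀ {A B} → Periodic B → ∀ t → t ≤ card B →
                   PollardBound (card B ∸ t) (∁ A) B → PollardBound t A B
  ∁-pollardBound {A} {B} B-per t t≤b bound =
    subst (λ b → t * (card A + b) ≤ ∑⊓rep t A B + t * t) (m∸n+n≡m t≤b)
      (pollard-duality-arith (card A) (card (∁ A)) u t (∑⊓rep u (∁ A) B) (∑⊓rep t A B)
        (subst (λ b → u * (card (∁ A) + b) ≤ ∑⊓rep u (∁ A) B + u * u) b≡u+t bound)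
        (subst₂ (λ n b → ∑⊓rep u (∁ A) B + n * t + card A * b ≡ n * b + ∑⊓rep t A B)
                (sym (card-∁ A)) b≡u+t (∑⊓rep-∁ B-per A t t≤b)))
    where
    u = card B ∸ t
    b≡u+t : card B ≡ u + t
    b≡u+t = sym (m∸n+n≡m t≤b)

  pollardBound-card : ∀ {A B} → Periodic B → PollardBound (card B) A B
  pollardBound-card {A} {B} B-per = ≤-reflexive (begin
    b * (a + b)                ≡⟨ expand a b ⟩
    a * b + b * b              ≡⟨ cong (_+ b * b) (∑⊓rep-card B-per A) ⟨
    ∑⊓rep b A B + b * b        ∎)
    where
    open ≡-Reasoning
    a = card A
    b = card B
    expand : ∀ a b → b * (a + b) ≡ a * b + b * b
    expand = solve-∀

  b∸t≤ā : ∀ {a ā b t} → ā + a ≡ N → a + b ≤ N + t → b ∸ t ≤ ā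
  b∸t≤ā {a} {ā} {b} {t} ā+a≡N a+b≤N+t = begin
    b ∸ t        ≤⟨ ∸-monoˡ-≤ t (+-cancelˡ-≤ a b (ā + t) a+b≤a+ā+t) ⟩
    ā + t ∸ t    ≡⟨ m+n∸n≡m ā t ⟩
    ā            ∎
    where
    open ≤-Reasoning
    a+b≤a+ā+t : a + b ≤ a + (ā + t)
    a+b≤a+ā+t = ≤-trans a+b≤N+t (≤-reflexive (trans (cong (_+ t) (sym ā+a≡N)) (rearrange ā a t)))
      where
      rearrange : ∀ ā a t → ā + a + t ≡ a + (ā + t)
      rearrange = solve-∀

  b∸t≤b″ : ∀ {b b′ b″ t} → b ≡ b′ + b″ → b′ ≤ t → b ∸ t ≤ b″
  b∸t≤b″ {b} {b′} {b″} {t} b≡b′+b″ b′≤t = begin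
    b ∸ t         ≤⟨ ∸-monoʳ-≤ b b′≤t ⟩
    b ∸ b′        ≡⟨ cong (_∸ b′) b≡b′+b″ ⟩
    b′ + b″ ∸ b′  ≡⟨ m+n∸m≡n b′ b″ ⟩
    b″            ∎
    where open ≤-Reasoning

  ā+b≤N+[b∸t] : ∀ {a ā b t} → ā + a ≡ N → t ≤ a → t ≤ b → ā + b ≤ N + (b ∸ t)
  ā+b≤N+[b∸t] {a} {ā} {b} {t} ā+a≡N t≤a t≤b = begin
    ā + b              ≡⟨ cong (ā +_) (m∸n+n≡m t≤b) ⟨
    ā + (b ∸ t + t)    ≤⟨ +-monoʳ-≤ ā (+-monoʳ-≤ (b ∸ t) t≤a) ⟩
    ā + (b ∸ t + a)    ≡⟨ rearrange ā (b ∸ t) a ⟩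
    ā + a + (b ∸ t)    ≡⟨ cong (_+ (b ∸ t)) ā+a≡N ⟩
    N + (b ∸ t)        ∎
    where
    open ≤-Reasoning
    rearrange : ∀ ā u a → ā + (u + a) ≡ ā + a + u
    rearrange = solve-∀

  PollardUpTo : ℕ → Set
  PollardUpTo fuel = ∀ {A B} t → Periodic A → Periodic B → card B ≤ fuel →
                     t ≤ card A → t ≤ card B → card A + card B ≤ N + t → PollardBound t A B

  module _ {fuel} (ih : PollardUpTo fuel) {A B : ℕ → Bool} (A-per : Periodic A) (B-per : Periodic B)
           {t} (t≤a : t ≤ card A) (a+b≤N+t : card A + card B ≤ N + t)
           (e : ℕ) (|B′|>0 : 0 < card (dysonB A B e)) (|B′|<|B| : card (dysonB A B e) < card B)
           (|B|≤1+fuel : card B ≤ suc fuel) where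

    pollard-step-dyson : t ≤ card (dysonB A B e) → PollardBound t A B
    pollard-step-dyson t≤|B′| =
      dyson-pollardBound A-per B-per e t
        (ih t (dysonA-periodic A-per B-per e) (dysonB-periodic A-per B-per e)
            (≤-pred (≤-trans |B′|<|B| |B|≤1+fuel))
            (≤-trans t≤a (≤-trans (m≤m+n (card A) _) (≤-reflexive (sym (card-dysonA A-per B-per e)))))
            t≤|B′|
            (≤-trans (≤-reflexive (card-dyson A-per B-per e)) a+b≤N+t))

    pollard-step-∁ : t ≤ card B → card (dysonB A B e) < t → PollardBound t A B
    pollard-step-∁ t≤b |B′|<t =
      ∁-pollardBound {A} B-per t t≤b
        (dyson-pollardBound ∁A-per B-per e u
          (ih u (dysonA-periodic ∁A-per B-per e) (dysonB-periodic ∁A-per B-per e)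
              |B″|≤fuel
              (≤-trans (b∸t≤ā {ā = ā} (card-∁ A) a+b≤N+t)
                       (≤-trans (m≤m+n ā _) (≤-reflexive (sym (card-dysonA ∁A-per B-per e)))))
              (b∸t≤b″ b≡b′+b″ (<⇒≤ |B′|<t))
              (≤-trans (≤-reflexive (card-dyson ∁A-per B-per e)) (ā+b≤N+[b∸t] {ā = ā} (card-∁ A) t≤a t≤b))))
      where
      ∁A-per : Periodic (∁ A)
      ∁A-per = ∁-periodic A-per
      ā = card (∁ A)
      u = card B ∸ t
      b≡b′+b″ : card B ≡ card (dysonB A B e) + card (dysonB (∁ A) B e)
      b≡b′+b″ = card-dysonB A-per B-per e
      |B″|≤fuel : card (dysonB (∁ A) B e) ≤ fuel
      |B″|≤fuel = ≤-pred (≤-trans (≤-trans (+-monoˡ-< _ |B′|>0) (≤-reflexive (sym b≡b′+b″))) |B|≤1+fuel)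

  pollard-upTo : ∀ fuel → PollardUpTo fuel
  pollard-upTo fuel zero _ _ _ _ _ _ = z≤n
  pollard-upTo fuel {A} {B} t@(suc _) A-per B-per |B|≤fuel t≤a t≤b a+b≤N+t with t ≟ card B
  ... | yes t≡b = subst (λ t → PollardBound t A B) (sym t≡b) (pollardBound-card {A} B-per)
  ... | no t≢b with fuel | ≤∧≢⇒< t≤b t≢b
  ...   | zero       | t<b = contradiction (≤-trans t<b |B|≤fuel) λ ()
  ...   | suc fuel-1 | t<b with ∃-proper-shift {B = B} A-per |A|>0 |A|<N |B|≥2
    where
    |A|>0 : 0 < card A
    |A|>0 = <-≤-trans z<s t≤a
    |A|<N : card A < N
    |A|<N = +-cancelʳ-< t (card A) N (<-≤-trans (+-monoʳ-< (card A) t<b) a+b≤N+t)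
    |B|≥2 : 2 ≤ card B
    |B|≥2 = <-≤-trans (s<s z<s) t<b
  ...     | e , |B′|>0 , |B′|<|B| with t ≤? card (dysonB A B e)
  ...       | yes t≤|B′| =
    pollard-step-dyson (pollard-upTo fuel-1) A-per B-per t≤a a+b≤N+t e |B′|>0 |B′|<|B| |B|≤fuel t≤|B′|
  ...       | no  t≰|B′| =
    pollard-step-∁ (pollard-upTo fuel-1) A-per B-per t≤a a+b≤N+t e |B′|>0 |B′|<|B| |B|≤fuel t≤b (≰⇒> t≰|B′|)

  pollard : ∀ {A B} t → Periodic A → Periodic B → t ≤ card A → t ≤ card B → card A + card B ≤ N + t → PollardBound t A B
  pollard {B = B} t A-per B-per = pollard-upTo (card B) t A-per B-per ≤-refl

module Counting (N-1 : ℕ) (n : Fin (suc N-1)) where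

  open import Data.Nat
  open import Data.Nat.Properties
  open import Data.Nat.Tactic.RingSolver using (solve-∀)
  open import Data.Fin using (Fin; toℕ)
  open import Data.Bool using (Bool; true; false; T)
  open import Data.List using (List; []; _∷_)
  open import Data.List.Relation.Binary.Permutation.Propositional using (_↭_; refl; prep; swap; trans)
  open import Function using (_∘_)
  open import Relation.Binary.PropositionalEquality hiding (trans)
  import Relation.Binary.PropositionalEquality as ≡
  open FiniteSums
  open Representations N-1

  record Item : Set where
    constructor item
    field
      set    : ℕ → Bool
      weight : ℕ
  open Item public

  count : List Item → ℕ → ℕ
  count []      acc = 𝟙 (acc % N ≡ᵇ toℕ n)
  count (X ∷ L) acc = ∑[ x < N ] (𝟙 (set X x) * count L (acc + x))

  count-≈ : ∀ L {u v} → u ≈ v → count L u ≡ count L v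
  count-≈ []      (mk≈ u%N≡v%N) = cong (λ z → 𝟙 (z ≡ᵇ toℕ n)) u%N≡v%N
  count-≈ (X ∷ L) u≈v = ∑-cong N (λ x → cong (𝟙 (set X x) *_) (count-≈ L (+-cong-≈ u≈v (≈-refl {x}))))

  count-periodic : ∀ L → Periodic (count L)
  count-periodic L acc = count-≈ L (≈-trans (+-cong-≈ (≈-refl {acc}) N≈0) (≈-reflexive (+-identityʳ acc)))

  count-swap : ∀ X Y L acc → count (X ∷ Y ∷ L) acc ≡ count (Y ∷ X ∷ L) acc
  count-swap X Y L acc = begin
    ∑[ x < N ] (χX x * ∑[ y < N ] (χY y * c x y))    ≡⟨ ∑-cong N (λ x → ∑-distribˡ-* N (χX x) (λ y → χY y * c x y)) ⟨
    ∑[ x < N ] ∑[ y < N ] (χX x * (χY y * c x y))    ≡⟨ ∑-comm N N (λ x y → χX x * (χY y * c x y)) ⟩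
    ∑[ y < N ] ∑[ x < N ] (χX x * (χY y * c x y))    ≡⟨ ∑-cong N (λ y → ∑-cong N λ x → *-left-comm (χX x) (χY y) (c x y)) ⟩
    ∑[ y < N ] ∑[ x < N ] (χY y * (χX x * c x y))    ≡⟨ ∑-cong N (λ y → ∑-distribˡ-* N (χY y) (λ x → χX x * c x y)) ⟩
    ∑[ y < N ] (χY y * ∑[ x < N ] (χX x * c x y))    ≡⟨ ∑-cong N (λ y → cong (χY y *_) (∑-cong N (λ x → cong (χX x *_)
                                                          (cong (count L) (+-right-comm acc x y))))) ⟩
    ∑[ y < N ] (χY y * ∑[ x < N ] (χX x * count L (acc + y + x))) ∎
    where
    open ≡-Reasoning
    χX = 𝟙 ∘ set X
    χY = 𝟙 ∘ set Y
    c = λ x y → count L (acc + x + y)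
    *-left-comm : ∀ a b c → a * (b * c) ≡ b * (a * c)
    *-left-comm = solve-∀
    +-right-comm : ∀ a x y → a + x + y ≡ a + y + x
    +-right-comm = solve-∀

  count-↭ : ∀ {L L′} → L ↭ L′ → ∀ acc → count L acc ≡ count L′ acc
  count-↭ refl            acc = ≡.refl
  count-↭ (prep X L↭L′)   acc = ∑-cong N (λ x → cong (𝟙 (set X x) *_) (count-↭ L↭L′ (acc + x)))
  count-↭ {X ∷ Y ∷ L} (swap _ _ L↭L′) acc = ≡.trans (count-swap X Y L acc)
    (∑-cong N (λ y → cong (𝟙 (set Y y) *_) (∑-cong N (λ x → cong (𝟙 (set X x) *_) (count-↭ L↭L′ (acc + y + x))))))
  count-↭ (trans L↭L′ L′↭L″) acc = ≡.trans (count-↭ L↭L′ acc) (count-↭ L′↭L″ acc)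

  count-cons-≥ : ∀ X L P Q → (∀ acc → P ≤ Q * count L acc) → ∀ acc → card (set X) * P ≤ Q * count (X ∷ L) acc
  count-cons-≥ X L P Q P≤Qc acc = begin
    card (set X) * P                         ≡⟨ ∑-distribʳ-* N P (𝟙 ∘ set X) ⟨
    ∑[ x < N ] (𝟙 (set X x) * P)             ≤⟨ ∑-mono-≤ N (λ x _ → *-monoʳ-≤ (𝟙 (set X x)) (P≤Qc (acc + x))) ⟩
    ∑[ x < N ] (𝟙 (set X x) * (Q * count L (acc + x))) ≡⟨ ∑-cong N (λ x → *-left-comm (𝟙 (set X x)) Q (count L (acc + x))) ⟩
    ∑[ x < N ] (Q * (𝟙 (set X x) * count L (acc + x))) ≡⟨ ∑-distribˡ-* N Q (λ x → 𝟙 (set X x) * count L (acc + x)) ⟩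
    Q * count (X ∷ L) acc                    ∎
    where
    open ≤-Reasoning
    *-left-comm : ∀ a b c → a * (b * c) ≡ b * (a * c)
    *-left-comm = solve-∀

  module _ (X Y : Item) (L : List Item) (Y-per : Periodic (set Y)) where

    count-merge : ∀ acc → count (X ∷ Y ∷ L) acc ≡ ∑[ y < N ] (rep (set X) (set Y) y * count L (acc + y))
    count-merge acc = begin
      ∑[ x < N ] (χX x * ∑[ z < N ] (χY z * count L (acc + x + z)))
        ≡⟨ ∑-cong N (λ x → cong (χX x *_) (reindex x)) ⟩
      ∑[ x < N ] (χX x * ∑[ y < N ] (χY (y + - x) * f y))
        ≡⟨ ∑-cong N (λ x → ∑-distribˡ-* N (χX x) (λ y → χY (y + - x) * f y)) ⟨
      ∑[ x < N ] ∑[ y < N ] (χX x * (χY (y + - x) * f y))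
        ≡⟨ ∑-comm N N (λ x y → χX x * (χY (y + - x) * f y)) ⟩
      ∑[ y < N ] ∑[ x < N ] (χX x * (χY (y + - x) * f y))
        ≡⟨ ∑-cong N (λ y → ∑-cong N (λ x → *-assoc (χX x) (χY (y + - x)) (f y))) ⟨
      ∑[ y < N ] ∑[ x < N ] (χX x * χY (y + - x) * f y)
        ≡⟨ ∑-cong N (λ y → ∑-distribʳ-* N (f y) (λ x → χX x * χY (y + - x))) ⟩
      ∑[ y < N ] (rep (set X) (set Y) y * f y)
        ∎
      where
      open ≡-Reasoning
      χX = 𝟙 ∘ set X
      χY = 𝟙 ∘ set Y
      f = λ w → count L (acc + w)
      reindex : ∀ x → ∑[ z < N ] (χY z * count L (acc + x + z)) ≡ ∑[ y < N ] (χY (y + - x) * f y)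
      reindex x = ≡.trans (sym (∑-periodic-shiftʳ g-per (- x)))
                    (∑-cong N (λ y → cong (χY (y + - x) *_) (count-≈ L (acc+x+[y-x]≈acc+y y))))
        where
        g-per : Periodic (λ z → χY z * count L (acc + x + z))
        g-per z = cong₂ _*_ (cong 𝟙 (Y-per z)) (periodic-+ˡ (count-periodic L) (acc + x) z)
        acc+x+[y-x]≈acc+y : ∀ y → acc + x + (y + - x) ≈ acc + y
        acc+x+[y-x]≈acc+y y = ≈-trans (≈-reflexive (+-comm-middle acc x y (- x))) (+-≈0ʳ (acc + y) (+-inverseʳ x))
          where
          +-comm-middle : ∀ a x y x̄ → a + x + (y + x̄) ≡ a + y + (x + x̄)
          +-comm-middle = solve-∀

    count-merge-≥ : ∀ s acc → s * count (item (λ y → s ≤ᵇ rep (set X) (set Y) y) 0 ∷ L) acc ≤ count (X ∷ Y ∷ L) acc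
    count-merge-≥ s acc = begin
      s * ∑[ y < N ] (𝟙 (s ≤ᵇ r y) * f y)    ≡⟨ ∑-distribˡ-* N s (λ y → 𝟙 (s ≤ᵇ r y) * f y) ⟨
      ∑[ y < N ] (s * (𝟙 (s ≤ᵇ r y) * f y))  ≤⟨ ∑-mono-≤ N (λ y _ → ≤-trans (≤-reflexive (sym (*-assoc s _ (f y))))
                                                                    (*-monoˡ-≤ (f y) (s*𝟙[s≤r]≤r s (r y)))) ⟩
      ∑[ y < N ] (r y * f y)                 ≡⟨ count-merge acc ⟨
      count (X ∷ Y ∷ L) acc                  ∎
      where
      open ≤-Reasoning
      r = rep (set X) (set Y)
      f = λ w → count L (acc + w)
      s*𝟙[s≤r]≤r : ∀ s r → s * 𝟙 (s ≤ᵇ r) ≤ r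
      s*𝟙[s≤r]≤r s r with s ≤ᵇ r in s≤ᵇr
      ... | true  = ≤-trans (≤-reflexive (*-identityʳ s)) (≤ᵇ⇒≤ s r (subst T (sym s≤ᵇr) _))
      ... | false = ≤-trans (≤-reflexive (*-zeroʳ s)) z≤n

module LowerBound (N-1 : ℕ) (prime : Prime (suc N-1)) (n : Fin (suc N-1)) where

  open import Data.Nat
  open import Data.Nat.Properties
  open import Data.Nat.DivMod
  open import Data.Fin using (Fin; toℕ)
  open import Data.Nat.ListAction using (sum)
  open import Data.Nat.ListAction.Properties using (sum-↭)
  open import Data.Nat.Tactic.RingSolver using (solve-∀)
  open import Data.Bool using (true)
  open import Data.Bool.Properties using (T-≡)
  open import Function.Bundles using (Equivalence)
  open import Data.List using (List; []; _∷_; length; map)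
  open import Data.List.Relation.Unary.All as All using (All; []; _∷_)
  open import Data.Fin.Properties using (toℕ<n)
  open import Data.List.Relation.Binary.Permutation.Propositional using (_↭_; ↭-sym; ↭-refl; ↭-prep; ↭-swap; ↭-trans)
  open import Data.List.Relation.Binary.Permutation.Propositional.Properties using (map⁺; ↭-length; All-resp-↭)
  open import Data.Product using (∃; ∃₂; _×_; _,_; proj₁; proj₂)
  open import Data.Sum using (_⊎_; inj₁; inj₂)
  open import Function using (_∘_)
  open import Relation.Binary.PropositionalEquality
  open import Relation.Nullary using (¬_; yes; no)
  open import Relation.Unary using (Decidable)
  open FiniteSums
  open Ceilings
  open Representations N-1
  open PollardTheorem N-1 prime
  open Counting N-1 n

  pick : ∀ {A : Set} {P : A → Set} → Decidable P → ∀ xs → (∃₂ λ x ys → P x × xs ↭ x ∷ ys) ⊎ All (¬_ ∘ P) xs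
  pick P? [] = inj₂ []
  pick P? (x ∷ xs) with P? x
  ... | yes px = inj₁ (x , xs , px , ↭-refl)
  ... | no ¬px with pick P? xs
  ...   | inj₂ ¬Pxs                   = inj₂ (¬px ∷ ¬Pxs)
  ...   | inj₁ (y , ys , py , xs↭y∷ys) = inj₁ (y , x ∷ ys , py , ↭-trans (↭-prep x xs↭y∷ys) (↭-swap x y ↭-refl))

  totalWeight : List Item → ℕ
  totalWeight = sum ∘ map weight

  totalWeight-↭ : ∀ {L L′} → L ↭ L′ → totalWeight L ≡ totalWeight L′
  totalWeight-↭ = sum-↭ ∘ map⁺ weight

  -- An item of weight w stands for a set of density at least w / D; m / D plays the role of θ.
  record Admissible (m D : ℕ) (X : Item) : Set where
    field
      periodic : Periodic (set X)
      m≤weight : m ≤ weight X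
      weight≤D : weight X ≤ D
      dense    : weight X * N ≤ D * card (set X)
  open Admissible

  module _ {m D : ℕ} (m>0 : 0 < m) (m≤D : m ≤ D) (DD+mD≤mmN : D * D + m * D ≤ m * m * N) where

    lower scale : ℕ → ℕ
    lower k = (m * m * N) ^ k * (m * N)
    scale k = (D * D) ^ k * D

    Bound : ℕ → List Item → Set
    Bound k L = ∀ acc → lower k ≤ scale k * count L acc

    Bound-↭ : ∀ {k L L′} → L ↭ L′ → Bound k L → Bound k L′
    Bound-↭ {k} L↭L′ bound acc = subst (λ c → lower k ≤ scale k * c) (count-↭ L↭L′ acc) (bound acc)

    Bound-suc : ∀ k c → m * m * N * lower k ≤ D * D * (scale k * c) → lower (suc k) ≤ scale (suc k) * c
    Bound-suc k c = subst₂ _≤_ (sym (*-assoc (m * m * N) _ (m * N))) (reassoc (D * D) ((D * D) ^ k) D c)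
      where
      reassoc : ∀ a b c d → a * (b * c * d) ≡ a * b * c * d
      reassoc = solve-∀

    bound-pair : ∀ X Y → Admissible m D X → Admissible m D Y → m + D ≤ weight X + weight Y → Bound 0 (X ∷ Y ∷ [])
    bound-pair X Y adX adY m+D≤wX+wY acc =
      subst₂ _≤_ (sym (*-identityˡ (m * N))) (cong (_* c) (sym (*-identityˡ D))) mN≤Dc
      where
      c = count (X ∷ Y ∷ []) acc
      r = rep (set X) (set Y)
      y₀ = (toℕ n + - acc) % N
      acc+y₀≈n : acc + y₀ ≈ toℕ n
      acc+y₀≈n = ≈-trans (+-cong-≈ (≈-refl {acc}) (%-≈ (toℕ n + - acc)))
                   (≈-trans (≈-reflexive (+-comm-middle acc (toℕ n) (- acc))) (+-≈0ʳ (toℕ n) (+-inverseʳ acc)))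
        where
        +-comm-middle : ∀ a n ā → a + (n + ā) ≡ n + (a + ā)
        +-comm-middle = solve-∀
      hit : count [] (acc + y₀) ≡ 1
      hit = trans (cong (λ z → 𝟙 (z ≡ᵇ toℕ n)) (trans (un≈ acc+y₀≈n) (m<n⇒m%n≡m (toℕ<n n)))) (𝟙-≡ᵇ-refl (toℕ n))
      r[y₀]≤c : r y₀ ≤ c
      r[y₀]≤c = begin
        r y₀                             ≡⟨ *-identityʳ (r y₀) ⟨
        r y₀ * 1                         ≡⟨ cong (r y₀ *_) hit ⟨
        r y₀ * count [] (acc + y₀)       ≤⟨ term≤∑ N (λ y → r y * count [] (acc + y)) (m%n<n (toℕ n + - acc) N) ⟩
        ∑[ y < N ] (r y * count [] (acc + y)) ≡⟨ count-merge X Y [] (periodic adY) acc ⟨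
        c                                ∎
        where open ≤-Reasoning
      mN≤Dc : m * N ≤ D * c
      mN≤Dc = +-cancelʳ-≤ (D * N) (m * N) (D * c) (begin
        m * N + D * N                          ≡⟨ *-distribʳ-+ N m D ⟨
        (m + D) * N                            ≤⟨ *-monoˡ-≤ N m+D≤wX+wY ⟩
        (weight X + weight Y) * N              ≡⟨ *-distribʳ-+ N (weight X) (weight Y) ⟩
        weight X * N + weight Y * N            ≤⟨ +-mono-≤ (dense adX) (dense adY) ⟩
        D * card (set X) + D * card (set Y)    ≡⟨ *-distribˡ-+ D (card (set X)) (card (set Y)) ⟨
        D * (card (set X) + card (set Y))      ≤⟨ *-monoʳ-≤ D (card+card≤rep+N (periodic adY) (set X) y₀) ⟩
        D * (r y₀ + N)                         ≤⟨ *-monoʳ-≤ D (+-monoˡ-≤ N r[y₀]≤c) ⟩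
        D * (c + N)                            ≡⟨ *-distribˡ-+ D c N ⟩
        D * c + D * N                          ∎)
        where open ≤-Reasoning

    bound-drop : ∀ {k} X L → Admissible m D X → Bound k L → Bound (suc k) (X ∷ L)
    bound-drop {k} X L adX bound acc = Bound-suc k (count (X ∷ L) acc) (begin
      m * m * N * lower k              ≡⟨ cong (_* lower k) (*-assoc m m N) ⟩
      m * (m * N) * lower k            ≤⟨ *-monoˡ-≤ (lower k) (*-mono-≤ m≤D mN≤D|X|) ⟩
      D * (D * card (set X)) * lower k ≡⟨ reassoc D (card (set X)) (lower k) ⟩
      D * D * (card (set X) * lower k) ≤⟨ *-monoʳ-≤ (D * D) (count-cons-≥ X L (lower k) (scale k) bound acc) ⟩
      D * D * (scale k * count (X ∷ L) acc) ∎)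
      where
      open ≤-Reasoning
      mN≤D|X| : m * N ≤ D * card (set X)
      mN≤D|X| = ≤-trans (*-monoˡ-≤ N (m≤weight adX)) (dense adX)
      reassoc : ∀ D a l → D * (D * a) * l ≡ D * D * (a * l)
      reassoc = solve-∀

    private
      D>0 : 0 < D
      D>0 = <-≤-trans m>0 m≤D

      t-ceiling : ∃ λ t → m * N ≤ D * t × D * t < m * N + D
      t-ceiling = ∃-ceiling (m * N) D D>0

      s-ceiling : ∃ λ s → m * m * N ≤ D * D * s × D * D * s < m * m * N + D * D
      s-ceiling = ∃-ceiling (m * m * N) (D * D) (*-mono-< D>0 D>0)

    t s : ℕ
    t = proj₁ t-ceiling
    s = proj₁ s-ceiling

    private
      mN≤Dt : m * N ≤ D * t
      mN≤Dt = proj₁ (proj₂ t-ceiling)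

      Dt<mN+D : D * t < m * N + D
      Dt<mN+D = proj₂ (proj₂ t-ceiling)

      DDs<mmN+DD : D * D * s < m * m * N + D * D
      DDs<mmN+DD = proj₂ (proj₂ s-ceiling)

      t>0 : 0 < t
      t>0 = n≢0⇒n>0 λ t≡0 → <⇒≱ (*-mono-< m>0 z<s) (≤-trans mN≤Dt (≤-reflexive (trans (cong (D *_) t≡0) (*-zeroʳ D))))

      s≤t : s ≤ t
      s≤t = ceiling-minimal DDs<mmN+DD (begin
        m * m * N   ≡⟨ *-assoc m m N ⟩
        m * (m * N) ≤⟨ *-mono-≤ m≤D mN≤Dt ⟩
        D * (D * t) ≡⟨ *-assoc D D t ⟨
        D * D * t   ∎)
        where open ≤-Reasoning

      t≤card : ∀ {X} → Admissible m D X → t ≤ card (set X)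
      t≤card adX = ceiling-minimal Dt<mN+D (≤-trans (*-monoˡ-≤ N (m≤weight adX)) (dense adX))

    excess : Item → Item → ℕ
    excess X Y = weight X + weight Y ∸ 3 * m

    merged : Item → Item → Item
    merged X Y = item (λ y → s ≤ᵇ rep (set X) (set Y) y) (excess X Y ⊓ D)

    merged-dense-full : ∀ X Y → Admissible m D Y → N + s ≤ card (set X) + card (set Y) →
                        weight (merged X Y) * N ≤ D * card (set (merged X Y))
    merged-dense-full X Y adY N+s≤a+b = begin
      (excess X Y ⊓ D) * N         ≤⟨ *-monoˡ-≤ N (m⊓n≤n (excess X Y) D) ⟩
      D * N                        ≡⟨ cong (D *_) (card-full full) ⟨
      D * card (set (merged X Y))  ∎
      where
      open ≤-Reasoning
      full : ∀ y → set (merged X Y) y ≡ true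
      full y = Equivalence.to T-≡ (≤⇒≤ᵇ (+-cancelˡ-≤ N s _ (begin
        N + s                          ≤⟨ N+s≤a+b ⟩
        card (set X) + card (set Y)    ≤⟨ card+card≤rep+N (periodic adY) (set X) y ⟩
        rep (set X) (set Y) y + N      ≡⟨ +-comm _ N ⟩
        N + rep (set X) (set Y) y      ∎)))

    merged-dense-sparse : ∀ X Y → Admissible m D X → Admissible m D Y → 3 * m ≤ weight X + weight Y →
                          card (set X) + card (set Y) < N + s → excess X Y * N ≤ D * card (set (merged X Y))
    merged-dense-sparse X Y adX adY 3m≤wX+wY a+b<N+s = +-cancelʳ-≤ (3 * m * N) _ _ (begin
      excess X Y * N + 3 * m * N    ≡⟨ *-distribʳ-+ N (excess X Y) (3 * m) ⟨
      (excess X Y + 3 * m) * N      ≡⟨ cong (_* N) (m∸n+n≡m 3m≤wX+wY) ⟩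
      (weight X + weight Y) * N     ≡⟨ *-distribʳ-+ N (weight X) (weight Y) ⟩
      weight X * N + weight Y * N   ≤⟨ +-mono-≤ (dense adX) (dense adY) ⟩
      D * a + D * b                 ≡⟨ *-distribˡ-+ D a b ⟨
      D * (a + b)                   ≤⟨ pollard-rescaled m N D t s a b (card Y′) D>0 t>0 DD+mD≤mmN m≤D
                                         mN≤Dt Dt<mN+D DDs<mmN+DD pollard-Y′ ⟩
      D * card Y′ + 3 * m * N       ∎)
      where
      open ≤-Reasoning
      Y′ = set (merged X Y)
      a = card (set X)
      b = card (set Y)
      pollard-Y′ : t * (a + b) ≤ t * card Y′ + s * N + t * t
      pollard-Y′ = ≤-trans (pollard t (periodic adX) (periodic adY) (t≤card adX) (t≤card adY)
                                    (<⇒≤ (<-≤-trans a+b<N+s (+-monoʳ-≤ N s≤t))))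
                           (+-monoˡ-≤ (t * t) (∑⊓rep≤threshold t s (set X) (set Y)))

    merged-dense : ∀ X Y → Admissible m D X → Admissible m D Y → 3 * m ≤ weight X + weight Y →
                   weight (merged X Y) * N ≤ D * card (set (merged X Y))
    merged-dense X Y adX adY 3m≤wX+wY with N + s ≤? card (set X) + card (set Y)
    ... | yes N+s≤a+b = merged-dense-full X Y adY N+s≤a+b
    ... | no  N+s≰a+b = ≤-trans (*-monoˡ-≤ N (m⊓n≤m (excess X Y) D))
                                (merged-dense-sparse X Y adX adY 3m≤wX+wY (≰⇒> N+s≰a+b))

    Large : Item → Set
    Large X = 3 * m < weight X

    merged-admissible : ∀ X Y → Admissible m D X → Admissible m D Y → Large X → Large Y → Admissible m D (merged X Y)
    merged-admissible X Y adX adY X-large Y-large = record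
      { periodic = λ y → cong (s ≤ᵇ_) (rep-periodic (periodic adY) (set X) y)
      ; m≤weight = ⊓-glb m≤excess m≤D
      ; weight≤D = m⊓n≤n (excess X Y) D
      ; dense    = merged-dense X Y adX adY (≤-trans (<⇒≤ X-large) (m≤m+n (weight X) (weight Y)))
      }
      where
      m≤excess : m ≤ excess X Y
      m≤excess = ≤-trans (m≤weight adY) (begin
        weight Y                       ≡⟨ m+n∸m≡n (3 * m) (weight Y) ⟨
        3 * m + weight Y ∸ 3 * m       ≤⟨ ∸-monoˡ-≤ (3 * m) (+-monoˡ-≤ (weight Y) (<⇒≤ X-large)) ⟩
        weight X + weight Y ∸ 3 * m    ∎)
        where open ≤-Reasoning

    large-totalWeight : ∀ L → All Large L → length L * (3 * m) ≤ totalWeight L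
    large-totalWeight []      []              = z≤n
    large-totalWeight (X ∷ L) (X-large ∷ Ls) = +-mono-≤ (<⇒≤ X-large) (large-totalWeight L Ls)

    merged-totalWeight : ∀ k X Y L → length L ≡ suc k → All Large L → Large X →
                         suc (3 * suc k) * m + D ≤ totalWeight (X ∷ Y ∷ L) →
                         suc (3 * k) * m + D ≤ totalWeight (merged X Y ∷ L)
    merged-totalWeight k X Y L len L-large X-large total≥ with ⊓-sel (excess X Y) D
    ... | inj₁ m′≡excess = subst (λ m′ → suc (3 * k) * m + D ≤ m′ + W) (sym m′≡excess) (+-cancelˡ-≤ (3 * m) _ _ (begin
      3 * m + (suc (3 * k) * m + D)   ≡⟨ expand m k D ⟩
      suc (3 * suc k) * m + D         ≤⟨ total≥ ⟩
      weight X + (weight Y + W)       ≡⟨ +-assoc (weight X) (weight Y) W ⟨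
      weight X + weight Y + W         ≡⟨ cong (_+ W) (m∸n+n≡m 3m≤wX+wY) ⟨
      excess X Y + 3 * m + W          ≡⟨ +-right-comm (excess X Y) (3 * m) W ⟩
      3 * m + (excess X Y + W)        ∎))
      where
      open ≤-Reasoning
      W = totalWeight L
      3m≤wX+wY = ≤-trans (<⇒≤ X-large) (m≤m+n (weight X) (weight Y))
      expand : ∀ m k D → 3 * m + (suc (3 * k) * m + D) ≡ suc (3 * suc k) * m + D
      expand = solve-∀
      +-right-comm : ∀ a b c → a + b + c ≡ b + (a + c)
      +-right-comm = solve-∀
    ... | inj₂ m′≡D  = subst (λ m′ → suc (3 * k) * m + D ≤ m′ + W) (sym m′≡D) (begin
      suc (3 * k) * m + D             ≡⟨ +-comm _ D ⟩
      D + suc (3 * k) * m             ≤⟨ +-monoʳ-≤ D (*-monoˡ-≤ m (s≤s (m≤n+m (3 * k) 2))) ⟩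
      D + (3 + 3 * k) * m             ≡⟨ cong (D +_) (factor k m) ⟩
      D + suc k * (3 * m)             ≡⟨ cong (λ l → D + l * (3 * m)) len ⟨
      D + length L * (3 * m)          ≤⟨ +-monoʳ-≤ D (large-totalWeight L L-large) ⟩
      D + W                           ∎)
      where
      open ≤-Reasoning
      W = totalWeight L
      factor : ∀ k m → (3 + 3 * k) * m ≡ suc k * (3 * m)
      factor = solve-∀

    bound-merge : ∀ {k} X Y L → Admissible m D Y → Bound k (merged X Y ∷ L) → Bound (suc k) (X ∷ Y ∷ L)
    bound-merge {k} X Y L adY bound acc = Bound-suc k (count (X ∷ Y ∷ L) acc) (begin
      m * m * N * lower k                        ≤⟨ *-mono-≤ (proj₁ (proj₂ s-ceiling)) (bound acc) ⟩
      D * D * s * (scale k * c′)                 ≡⟨ reassoc (D * D) s (scale k) c′ ⟩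
      D * D * (scale k * (s * c′))               ≤⟨ *-monoʳ-≤ (D * D)
                                                      (*-monoʳ-≤ (scale k) (count-merge-≥ X Y L (periodic adY) s acc)) ⟩
      D * D * (scale k * count (X ∷ Y ∷ L) acc)  ∎)
      where
      open ≤-Reasoning
      c′ = count (merged X Y ∷ L) acc
      reassoc : ∀ a s q c → a * s * (q * c) ≡ a * (q * (s * c))
      reassoc = solve-∀

    lower-bound : ∀ k L → length L ≡ 2 + k → All (Admissible m D) L → suc (3 * k) * m + D ≤ totalWeight L → Bound k L
    lower-bound zero (X ∷ Y ∷ []) _ (adX ∷ adY ∷ []) total≥ =
      bound-pair X Y adX adY (subst₂ _≤_ (cong (_+ D) (*-identityˡ m)) (cong (weight X +_) (+-identityʳ (weight Y))) total≥)
    lower-bound (suc k) L len adm total≥ with pick (λ X → weight X ≤? 3 * m) L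
    ... | inj₁ (X , L′ , X-small , L↭X∷L′) =
      Bound-↭ {suc k} (↭-sym L↭X∷L′) (bound-drop {k} X L′ adX (lower-bound k L′ len′ adm′ total′))
      where
      adX  = All.head (All-resp-↭ L↭X∷L′ adm)
      adm′ = All.tail (All-resp-↭ L↭X∷L′ adm)
      len′ : length L′ ≡ 2 + k
      len′ = suc-injective (trans (sym (↭-length L↭X∷L′)) len)
      total′ : suc (3 * k) * m + D ≤ totalWeight L′
      total′ = +-cancelˡ-≤ (3 * m) _ _ (begin
        3 * m + (suc (3 * k) * m + D)  ≡⟨ expand m k D ⟩
        suc (3 * suc k) * m + D        ≤⟨ total≥ ⟩
        totalWeight L                  ≡⟨ totalWeight-↭ L↭X∷L′ ⟩
        weight X + totalWeight L′      ≤⟨ +-monoˡ-≤ (totalWeight L′) X-small ⟩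
        3 * m + totalWeight L′         ∎)
        where
        open ≤-Reasoning
        expand : ∀ m k D → 3 * m + (suc (3 * k) * m + D) ≡ suc (3 * suc k) * m + D
        expand = solve-∀
    lower-bound (suc k) (X ∷ Y ∷ L) len (adX ∷ adY ∷ adm) total≥ | inj₂ (X-small? ∷ Y-small? ∷ L-small?) =
      bound-merge {k} X Y L adY (lower-bound k (merged X Y ∷ L) (cong suc lenL)
                         (merged-admissible X Y adX adY X-large Y-large ∷ adm)
                         (merged-totalWeight k X Y L lenL L-large X-large total≥))
      where
      X-large = ≰⇒> X-small?
      Y-large = ≰⇒> Y-small?
      L-large = All.map ≰⇒> L-small?
      lenL : length L ≡ suc k
      lenL = suc-injective (suc-injective len)

module TupleCounting (N-1 : ℕ) (n : Fin (suc N-1)) where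

  open import Data.Nat
  open import Data.Nat.Properties using (+-assoc; +-identityʳ; *-zeroʳ; *-distribˡ-+)
  open import Data.Nat.DivMod using (_mod_; [m+n]%n≡m%n; m<n⇒m%n≡m)
  open import Data.Nat.ListAction using (sum)
  open import Data.Nat.ListAction.Properties using (sum-++)
  open import Data.Bool using (Bool; true; false; _∧_)
  open import Data.Bool.Properties using (∧-assoc)
  open import Data.Fin using (Fin; toℕ; zero; suc)
  open import Data.Fin.Properties using (all?; toℕ-injective; toℕ-fromℕ<; toℕ<n)
  open import Data.Fin.Subset using (Subset; ∣_∣; inside; outside)
  open import Data.Fin.Subset.Properties using (_∈?_)
  open import Data.List using (List; []; _∷_; map; filter; length; concatMap; tabulate; allFin; _++_)
  open import Data.List.Properties using (map-tabulate; map-++; map-∘; map-cong; tabulate-cong)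
  open import Data.Vec using (Vec; []; _∷_; lookup; toList)
  open import Function using (_∘_)
  open import Relation.Binary.PropositionalEquality
  open import Relation.Nullary using (does)
  open import Relation.Nullary.Decidable using (_×-dec_)
  open import Relation.Unary using (Decidable)
  open FiniteSums
  open Representations N-1
  open Counting N-1 n

  length-filter≡sum : ∀ {A : Set} {P : A → Set} (P? : Decidable P) xs → length (filter P? xs) ≡ sum (map (𝟙 ∘ does ∘ P?) xs)
  length-filter≡sum P? []       = refl
  length-filter≡sum P? (x ∷ xs) with does (P? x)
  ... | true  = cong suc (length-filter≡sum P? xs)
  ... | false = length-filter≡sum P? xs

  sum-map-concatMap : ∀ {A B : Set} (g : B → ℕ) (f : A → List B) xs →
                      sum (map g (concatMap f xs)) ≡ sum (map (sum ∘ map g ∘ f) xs)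
  sum-map-concatMap g f []       = refl
  sum-map-concatMap g f (x ∷ xs) = begin
    sum (map g (f x ++ concatMap f xs))              ≡⟨ cong sum (map-++ g (f x) (concatMap f xs)) ⟩
    sum (map g (f x) ++ map g (concatMap f xs))      ≡⟨ sum-++ (map g (f x)) _ ⟩
    sum (map g (f x)) + sum (map g (concatMap f xs)) ≡⟨ cong (sum (map g (f x)) +_) (sum-map-concatMap g f xs) ⟩
    sum (map g (f x)) + sum (map (sum ∘ map g ∘ f) xs) ∎
    where open ≡-Reasoning

  sum-map-*ˡ : ∀ {A : Set} c (f : A → ℕ) xs → sum (map (λ x → c * f x) xs) ≡ c * sum (map f xs)
  sum-map-*ˡ c f []       = sym (*-zeroʳ c)
  sum-map-*ˡ c f (x ∷ xs) = trans (cong (c * f x +_) (sum-map-*ˡ c f xs)) (sym (*-distribˡ-+ c (f x) _))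

  sum-tabulate-toℕ : ∀ m (f : ℕ → ℕ) → sum (tabulate (f ∘ toℕ {m})) ≡ ∑ m f
  sum-tabulate-toℕ zero    f = refl
  sum-tabulate-toℕ (suc m) f = cong (f 0 +_) (sum-tabulate-toℕ m (f ∘ suc))

  χ : Subset N → ℕ → Bool
  χ P x = does ((x mod N) ∈? P)

  toℕ-mod : ∀ (i : Fin N) → toℕ i mod N ≡ i
  toℕ-mod i = toℕ-injective (trans (toℕ-fromℕ< _) (m<n⇒m%n≡m (toℕ<n i)))

  χ-periodic : ∀ P → Periodic (χ P)
  χ-periodic P x =
    cong (λ j → does (j ∈? P)) (toℕ-injective (trans (toℕ-fromℕ< _) (trans ([m+n]%n≡m%n x N) (sym (toℕ-fromℕ< _)))))

  card-χ : ∀ P → card (χ P) ≡ ∣ P ∣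
  card-χ P = begin
    ∑[ x < N ] 𝟙 (χ P x)                              ≡⟨ sum-tabulate-toℕ N (𝟙 ∘ χ P) ⟨
    sum (tabulate {n = N} (λ i → 𝟙 (χ P (toℕ i))))    ≡⟨ cong sum (tabulate-cong λ i → cong (λ j → 𝟙 (does (j ∈? P))) (toℕ-mod i)) ⟩
    sum (tabulate {n = N} (λ i → 𝟙 (does (i ∈? P))))  ≡⟨ sum-∈?≡∣∣ P ⟩
    ∣ P ∣                                             ∎
    where
    open ≡-Reasoning
    sum-∈?≡∣∣ : ∀ {m} (P : Subset m) → sum (tabulate (λ i → 𝟙 (does (i ∈? P)))) ≡ ∣ P ∣
    sum-∈?≡∣∣ []            = refl
    sum-∈?≡∣∣ (inside ∷ P)  = cong suc (sum-∈?≡∣∣ P)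
    sum-∈?≡∣∣ (outside ∷ P) = sum-∈?≡∣∣ P

  accepts : ∀ {k} → (Fin k → Subset N) → ℕ → Vec (Fin N) k → Bool
  accepts X acc xs = does (all? (λ i → lookup xs i ∈? X i) ×-dec (modN N (acc + sum (map toℕ (toList xs))) ≟ toℕ n))

  ν≡sum-accepts : ∀ k X → ν N k X n ≡ sum (map (𝟙 ∘ accepts X 0) (allTuples k N))
  ν≡sum-accepts k X = length-filter≡sum _ (allTuples k N)

  accepts-∷ : ∀ {k} (X : Fin (suc k) → Subset N) acc x xs →
              accepts X acc (x ∷ xs) ≡ does (x ∈? X zero) ∧ accepts (X ∘ suc) (acc + toℕ x) xs
  accepts-∷ X acc x xs = trans
    (cong (λ z → (does (x ∈? X zero) ∧ does (all? (λ i → lookup xs i ∈? X (suc i)))) ∧ (z % N ≡ᵇ toℕ n))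
          (sym (+-assoc acc (toℕ x) (sum (map toℕ (toList xs))))))
    (∧-assoc (does (x ∈? X zero)) _ _)

  items : ∀ {k} → (Fin k → Subset N) → (Fin k → ℕ) → List Item
  items X w = tabulate (λ i → item (χ (X i)) (w i))

  sum-accepts≡count : ∀ k (X : Fin k → Subset N) w acc → sum (map (𝟙 ∘ accepts X acc) (allTuples k N)) ≡ count (items X w) acc
  sum-accepts≡count zero    X w acc = trans (+-identityʳ _) (cong (λ z → 𝟙 (z % N ≡ᵇ toℕ n)) (+-identityʳ acc))
  sum-accepts≡count (suc k) X w acc = begin
    sum (map (𝟙 ∘ accepts X acc) (concatMap (λ x → map (x ∷_) tuples) (allFin N)))
      ≡⟨ sum-map-concatMap (𝟙 ∘ accepts X acc) (λ x → map (x ∷_) tuples) (allFin N) ⟩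
    sum (map (λ x → sum (map (𝟙 ∘ accepts X acc) (map (x ∷_) tuples))) (allFin N))
      ≡⟨ cong sum (map-cong first-step (allFin N)) ⟩
    sum (map f (allFin N))
      ≡⟨ cong sum (map-tabulate (λ x → x) f) ⟩
    sum (tabulate {n = N} f)
      ≡⟨ sum-tabulate-toℕ N (λ y → 𝟙 (χ (X zero) y) * count (items (X ∘ suc) (w ∘ suc)) (acc + y)) ⟩
    count (items X w) acc ∎
    where
    open ≡-Reasoning
    tuples = allTuples k N
    f : Fin N → ℕ
    f x = 𝟙 (χ (X zero) (toℕ x)) * count (items (X ∘ suc) (w ∘ suc)) (acc + toℕ x)
    first-step : ∀ x → sum (map (𝟙 ∘ accepts X acc) (map (x ∷_) tuples))
                     ≡ 𝟙 (χ (X zero) (toℕ x)) * count (items (X ∘ suc) (w ∘ suc)) (acc + toℕ x)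
    first-step x = begin
      sum (map (𝟙 ∘ accepts X acc) (map (x ∷_) tuples))
        ≡⟨ cong sum (map-∘ {g = 𝟙 ∘ accepts X acc} {f = x ∷_} tuples) ⟨
      sum (map (𝟙 ∘ accepts X acc ∘ (x ∷_)) tuples)
        ≡⟨ cong sum (map-cong (λ xs → trans (cong 𝟙 (accepts-∷ X acc x xs)) (𝟙-∧ (does (x ∈? X zero)) _)) tuples) ⟩
      sum (map (λ xs → x∈X₀ * 𝟙 (accepts (X ∘ suc) (acc + toℕ x) xs)) tuples)
        ≡⟨ sum-map-*ˡ x∈X₀ (𝟙 ∘ accepts (X ∘ suc) (acc + toℕ x)) tuples ⟩
      x∈X₀ * sum (map (𝟙 ∘ accepts (X ∘ suc) (acc + toℕ x)) tuples)
        ≡⟨ cong₂ _*_ (cong (λ j → 𝟙 (does (j ∈? X zero))) (sym (toℕ-mod x)))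
                     (sum-accepts≡count k (X ∘ suc) (w ∘ suc) (acc + toℕ x)) ⟩
      𝟙 (χ (X zero) (toℕ x)) * count (items (X ∘ suc) (w ∘ suc)) (acc + toℕ x)
        ∎
      where x∈X₀ = 𝟙 (does (x ∈? X zero))

module ClearDenominators (j : ℕ) (θs : Fin (suc (suc j)) → ℚ)
                         (θs>0 : ∀ i → 0ℚ ℚ.< θs i) (θs≤1 : ∀ i → θs i ℚ.≤ 1ℚ) (Σθ>1 : 1ℚ ℚ.< sumℚ (suc (suc j)) θs)
                         (N : ℕ) (2<θ²N : ℕtoℚ 2 ℚ.< (θmin (suc (suc j)) θs ^ℚ 2) ℚ.* ℕtoℚ N) where

  open import Data.Nat using (ℕ; zero; suc; _≤_; _<_; _∸_)
  import Data.Nat as ℕ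
  import Data.Nat.Properties as ℕ
  open import Data.Nat.ListAction using (sum; product)
  open import Data.Nat.ListAction.Properties using (∈⇒∣product; product≢0)
  open import Data.Nat.Divisibility using (∣-trans; m∣m*n; n∣m*n)
  open import Data.Nat.Tactic.RingSolver using (solve-∀)
  open import Data.Fin as Fin using (Fin)
  open import Data.List using (List; map; allFin; tabulate)
  open import Data.List.Properties using (map-tabulate)
  open import Data.List.Membership.Propositional.Properties using (∈-tabulate⁺)
  open import Data.List.Relation.Unary.All.Properties using (tabulate⁺)
  open import Data.Rational using (ℚ; 0ℚ; 1ℚ; ↧ₙ_; _*_; _+_; _-_; _⊓_; nonNegative) renaming (_≤_ to _≤ℚ_)
  open import Data.Rational.Properties
  open import Data.Rational.Solver using (module +-*-Solver)
  open import Data.Product using (∃; proj₁; proj₂)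
  open import Function using (_∘_)
  open import Relation.Binary.PropositionalEquality
  open RationalEmbedding

  k : ℕ
  k = suc (suc j)

  θ Σθ θ-bound : ℚ
  θ = θmin k θs
  Σθ = sumℚ k θs
  θ-bound = (Σθ - 1ℚ) * inv3k-5 k

  θs-tabulate : map θs (allFin k) ≡ tabulate θs
  θs-tabulate = map-tabulate (λ i → i) θs

  θ≤θs : ∀ i → θ ≤ℚ θs i
  θ≤θs i = subst (λ xs → Data.List.foldr _⊓_ θ-bound xs ≤ℚ θs i) (sym θs-tabulate) (foldr-⊓-≤ θ-bound θs i)

  θ≤θ-bound : θ ≤ℚ θ-bound
  θ≤θ-bound = subst (λ xs → Data.List.foldr _⊓_ θ-bound xs ≤ℚ θ-bound) (sym θs-tabulate) (foldr-⊓-≤-init θ-bound θs)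

  0≤θ : 0ℚ ≤ℚ θ
  0≤θ = subst (λ xs → 0ℚ ≤ℚ Data.List.foldr _⊓_ θ-bound xs) (sym θs-tabulate)
          (≤-foldr-⊓ θ-bound θs 0≤θ-bound (<⇒≤ ∘ θs>0))
    where
    0≤Σθ-1 : 0ℚ ≤ℚ Σθ - 1ℚ
    0≤Σθ-1 = subst (_≤ℚ Σθ - 1ℚ) (+-inverseʳ 1ℚ) (+-monoˡ-≤ (Data.Rational.- 1ℚ) (<⇒≤ Σθ>1))
    0≤θ-bound : 0ℚ ≤ℚ θ-bound
    0≤θ-bound = subst (_≤ℚ θ-bound) (*-zeroˡ (inv3k-5 k)) (*-monoʳ-≤-nonNeg (inv3k-5 k) {{nonNegative (0≤inv3k-5 j)}} 0≤Σθ-1)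

  denominators : List ℕ
  denominators = tabulate (↧ₙ_ ∘ θs)

  D : ℕ
  D = ↧ₙ θ ℕ.* product denominators

  D>0 : 0 < D
  D>0 = ℕ.>-nonZero⁻¹ D {{ℕ.m*n≢0 (↧ₙ θ) (product denominators) {{_}} {{product≢0 (tabulate⁺ {f = ↧ₙ_ ∘ θs} λ _ → _)}}}}

  m : ℕ
  m = proj₁ (∣⇒integral θ D 0≤θ (m∣m*n (product denominators)))

  θD≡m : θ * ℕtoℚ D ≡ ℕtoℚ m
  θD≡m = proj₂ (∣⇒integral θ D 0≤θ (m∣m*n (product denominators)))

  θs-integral : ∀ i → ∃ λ a → θs i * ℕtoℚ D ≡ ℕtoℚ a
  θs-integral i = ∣⇒integral (θs i) D (<⇒≤ (θs>0 i))
                    (∣-trans (∈⇒∣product (∈-tabulate⁺ {f = ↧ₙ_ ∘ θs} i)) (n∣m*n (↧ₙ θ)))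

  ms : Fin k → ℕ
  ms i = proj₁ (θs-integral i)

  θsD≡ms : ∀ i → θs i * ℕtoℚ D ≡ ℕtoℚ (ms i)
  θsD≡ms i = proj₂ (θs-integral i)

  m≤ms : ∀ i → m ≤ ms i
  m≤ms i = ≤⇒cleared-≤ D θD≡m (θsD≡ms i) (θ≤θs i)

  ms≤D : ∀ i → ms i ≤ D
  ms≤D i = ≤⇒cleared-≤ D (θsD≡ms i) (*-identityˡ (ℕtoℚ D)) (θs≤1 i)

  ms-dense : ∀ {N c} i → θs i * ℕtoℚ N ≤ℚ ℕtoℚ c → ms i ℕ.* N ≤ D ℕ.* c
  ms-dense {N} {c} i θsN≤c = subst (ms i ℕ.* N ≤_) (ℕ.*-comm c D) (≤⇒cleared-≤ D θsND≡msN (sym (ℕtoℚ-* c D)) θsN≤c)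
    where
    open ≡-Reasoning
    θsND≡msN : θs i * ℕtoℚ N * ℕtoℚ D ≡ ℕtoℚ (ms i ℕ.* N)
    θsND≡msN = begin
      θs i * ℕtoℚ N * ℕtoℚ D     ≡⟨ *-right-comm (θs i) (ℕtoℚ N) (ℕtoℚ D) ⟩
      θs i * ℕtoℚ D * ℕtoℚ N     ≡⟨ cong (_* ℕtoℚ N) (θsD≡ms i) ⟩
      ℕtoℚ (ms i) * ℕtoℚ N       ≡⟨ ℕtoℚ-* (ms i) N ⟨
      ℕtoℚ (ms i ℕ.* N)          ∎
      where
      open +-*-Solver
      *-right-comm : ∀ a b c → a * b * c ≡ a * c * b
      *-right-comm = solve 3 (λ a b c → a :* b :* c := a :* c :* b) refl

  total-weight : suc (3 ℕ.* j) ℕ.* m ℕ.+ D ≤ sum (tabulate ms)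
  total-weight = ≤⇒cleared-≤ D lhs rhs θc+1≤Σθ
    where
    open +-*-Solver
    c = ℕtoℚ (suc (3 ℕ.* j))
    θc+1≤Σθ : θ * c + 1ℚ ≤ℚ Σθ
    θc+1≤Σθ = begin
      θ * c + 1ℚ                        ≤⟨ +-monoˡ-≤ 1ℚ (*-monoʳ-≤-nonNeg c {{ℕtoℚ-nonNeg (suc (3 ℕ.* j))}} θ≤θ-bound) ⟩
      (Σθ - 1ℚ) * inv3k-5 k * c + 1ℚ    ≡⟨ cong (_+ 1ℚ) (*-assoc (Σθ - 1ℚ) (inv3k-5 k) c) ⟩
      (Σθ - 1ℚ) * (inv3k-5 k * c) + 1ℚ  ≡⟨ cong (λ z → (Σθ - 1ℚ) * z + 1ℚ) (inv3k-5*[3k-5] j) ⟩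
      (Σθ - 1ℚ) * 1ℚ + 1ℚ               ≡⟨ simplify Σθ ⟩
      Σθ                                ∎
      where
      open ≤-Reasoning
      simplify : ∀ s → (s - 1ℚ) * 1ℚ + 1ℚ ≡ s
      simplify = solve 1 (λ s → (s :- con 1ℚ) :* con 1ℚ :+ con 1ℚ := s) refl
    lhs : (θ * c + 1ℚ) * ℕtoℚ D ≡ ℕtoℚ (suc (3 ℕ.* j) ℕ.* m ℕ.+ D)
    lhs = begin
      (θ * c + 1ℚ) * ℕtoℚ D              ≡⟨ expand θ c (ℕtoℚ D) ⟩
      c * (θ * ℕtoℚ D) + ℕtoℚ D          ≡⟨ cong (λ z → c * z + ℕtoℚ D) θD≡m ⟩
      c * ℕtoℚ m + ℕtoℚ D                ≡⟨ cong (_+ ℕtoℚ D) (ℕtoℚ-* (suc (3 ℕ.* j)) m) ⟨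
      ℕtoℚ (suc (3 ℕ.* j) ℕ.* m) + ℕtoℚ D ≡⟨ ℕtoℚ-+ (suc (3 ℕ.* j) ℕ.* m) D ⟨
      ℕtoℚ (suc (3 ℕ.* j) ℕ.* m ℕ.+ D)   ∎
      where
      open ≡-Reasoning
      expand : ∀ t c d → (t * c + 1ℚ) * d ≡ c * (t * d) + d
      expand = solve 3 (λ t c d → (t :* c :+ con 1ℚ) :* d := c :* (t :* d) :+ d) refl
    rhs : Σθ * ℕtoℚ D ≡ ℕtoℚ (sum (tabulate ms))
    rhs = trans (cong (λ xs → Data.List.foldr _+_ 0ℚ xs * ℕtoℚ D) θs-tabulate) (foldr-+-scaled D θs ms θsD≡ms)

  2DD<mmN : 2 ℕ.* (D ℕ.* D) < m ℕ.* m ℕ.* N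
  2DD<mmN = <⇒cleared-< (D ℕ.* D) (sym (ℕtoℚ-* 2 (D ℕ.* D))) θ²NDD≡mmN (ℕ.*-mono-< D>0 D>0) 2<θ²N
    where
    open ≡-Reasoning
    open +-*-Solver
    θ²NDD≡mmN : θ ^ℚ 2 * ℕtoℚ N * ℕtoℚ (D ℕ.* D) ≡ ℕtoℚ (m ℕ.* m ℕ.* N)
    θ²NDD≡mmN = begin
      θ ^ℚ 2 * ℕtoℚ N * ℕtoℚ (D ℕ.* D)              ≡⟨ cong (θ ^ℚ 2 * ℕtoℚ N *_) (ℕtoℚ-* D D) ⟩
      θ ^ℚ 2 * ℕtoℚ N * (ℕtoℚ D * ℕtoℚ D)           ≡⟨ rearrange θ (ℕtoℚ N) (ℕtoℚ D) ⟩
      θ * ℕtoℚ D * (θ * ℕtoℚ D) * ℕtoℚ N            ≡⟨ cong (λ z → z * z * ℕtoℚ N) θD≡m ⟩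
      ℕtoℚ m * ℕtoℚ m * ℕtoℚ N                      ≡⟨ cong (_* ℕtoℚ N) (ℕtoℚ-* m m) ⟨
      ℕtoℚ (m ℕ.* m) * ℕtoℚ N                       ≡⟨ ℕtoℚ-* (m ℕ.* m) N ⟨
      ℕtoℚ (m ℕ.* m ℕ.* N)                          ∎
      where
      rearrange : ∀ t n d → t * (t * 1ℚ) * n * (d * d) ≡ t * d * (t * d) * n
      rearrange = solve 3 (λ t n d → t :* (t :* con 1ℚ) :* n :* (d :* d) := t :* d :* (t :* d) :* n) refl

  E : ℕ
  E = (D ℕ.* D) ℕ.^ j ℕ.* D

  E>0 : 0 < E
  E>0 = ℕ.*-mono-< (ℕ.m^n>0 (D ℕ.* D) {{ℕ.m*n≢0 D D {{ℕ.>-nonZero D>0}} {{ℕ.>-nonZero D>0}}}} j) D>0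

  m≤D : m ≤ D
  m≤D = ℕ.≤-trans (m≤ms Fin.zero) (ms≤D Fin.zero)

  m>0 : 0 < m
  m>0 = ℕ.n≢0⇒n>0 λ m≡0 → ℕ.n≮0 (subst (λ m → 2 ℕ.* (D ℕ.* D) < m ℕ.* m ℕ.* N) m≡0 2DD<mmN)

  DD+mD≤mmN : D ℕ.* D ℕ.+ m ℕ.* D ≤ m ℕ.* m ℕ.* N
  DD+mD≤mmN = begin
    D ℕ.* D ℕ.+ m ℕ.* D      ≤⟨ ℕ.+-monoʳ-≤ (D ℕ.* D) (ℕ.*-monoˡ-≤ D m≤D) ⟩
    D ℕ.* D ℕ.+ D ℕ.* D      ≡⟨ cong (D ℕ.* D ℕ.+_) (ℕ.+-identityʳ (D ℕ.* D)) ⟨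
    2 ℕ.* (D ℕ.* D)          <⟨ 2DD<mmN ⟩
    m ℕ.* m ℕ.* N            ∎
    where open ℕ.≤-Reasoning

  power-scaled : θ ^ℚ (2 ℕ.* k ∸ 3) * ℕtoℚ N ^ℚ (k ∸ 1) * ℕtoℚ E ≡ ℕtoℚ ((m ℕ.* m ℕ.* N) ℕ.^ j ℕ.* (m ℕ.* N))
  power-scaled = begin
    θ ^ℚ (2 ℕ.* k ∸ 3) * N′ ^ℚ suc j * ℕtoℚ ((D ℕ.* D) ℕ.^ j ℕ.* D)
      ≡⟨ cong₂ (λ e E → θ ^ℚ e * N′ ^ℚ suc j * E) 2k-3≡1+j+j
               (trans (ℕtoℚ-* ((D ℕ.* D) ℕ.^ j) D) (cong (_* D′) (trans (ℕtoℚ-^ (D ℕ.* D) j) (cong (_^ℚ j) (ℕtoℚ-* D D))))) ⟩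
    θ ^ℚ suc (j ℕ.+ j) * N′ ^ℚ suc j * ((D′ * D′) ^ℚ j * D′)
      ≡⟨ ^ℚ-regroup j θ N′ D′ ⟩
    ((θ * D′) * (θ * D′) * N′) ^ℚ j * ((θ * D′) * N′)
      ≡⟨ cong (λ z → (z * z * N′) ^ℚ j * (z * N′)) θD≡m ⟩
    (ℕtoℚ m * ℕtoℚ m * N′) ^ℚ j * (ℕtoℚ m * N′)
      ≡⟨ cong₂ (λ a b → a ^ℚ j * b) (trans (cong (_* N′) (sym (ℕtoℚ-* m m))) (sym (ℕtoℚ-* (m ℕ.* m) N)))
                                     (sym (ℕtoℚ-* m N)) ⟩
    ℕtoℚ (m ℕ.* m ℕ.* N) ^ℚ j * ℕtoℚ (m ℕ.* N)
      ≡⟨ trans (cong (_* ℕtoℚ (m ℕ.* N)) (sym (ℕtoℚ-^ (m ℕ.* m ℕ.* N) j)))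
               (sym (ℕtoℚ-* ((m ℕ.* m ℕ.* N) ℕ.^ j) (m ℕ.* N))) ⟩
    ℕtoℚ ((m ℕ.* m ℕ.* N) ℕ.^ j ℕ.* (m ℕ.* N)) ∎
    where
    open ≡-Reasoning
    N′ = ℕtoℚ N
    D′ = ℕtoℚ D
    2k-3≡1+j+j : 2 ℕ.* k ∸ 3 ≡ suc (j ℕ.+ j)
    2k-3≡1+j+j = trans (cong (_∸ 3) (double j)) (ℕ.m+n∸m≡n 3 (suc (j ℕ.+ j)))
      where
      double : ∀ j → 2 ℕ.* suc (suc j) ≡ 3 ℕ.+ suc (j ℕ.+ j)
      double = solve-∀

open import Data.Nat using (ℕ; _≤_; _∸_)
open import Data.Fin.Subset using (Subset; ∣_∣)
open import Data.Rational using (ℚ; 0ℚ; 1ℚ; _<_; _*_) renaming (_≤_ to _≤ℚ_)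
import Data.Nat as ℕ
open import Data.Nat.ListAction using (sum)
open import Data.List.Properties using (length-tabulate; map-tabulate)
open import Data.List.Relation.Unary.All using (All)
open import Data.List.Relation.Unary.All.Properties using (tabulate⁺)
open import Relation.Binary.PropositionalEquality using (_≡_; cong; subst; sym; trans)
open RationalEmbedding using (cleared-≤⇒≤ℕtoℚ)

lemma3p3 : (k : ℕ) → 2 ≤ k → (θs : Fin k → ℚ)
    → (∀ i → 0ℚ < θs i) → (∀ i → θs i ≤ℚ 1ℚ) → 1ℚ < sumℚ k θs
    → (N : ℕ) → Prime N → ℕtoℚ 2 < (θmin k θs ^ℚ 2) * ℕtoℚ N
    → (X : Fin k → Subset N) → (∀ i → θs i * ℕtoℚ N ≤ℚ ℕtoℚ ∣ X i ∣)
    → (n : Fin N) → (θmin k θs ^ℚ (2 Data.Nat.* k ∸ 3)) * (ℕtoℚ N ^ℚ (k ∸ 1)) ≤ℚ ℕtoℚ (ν N k X n)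
lemma3p3 (suc (suc j)) (ℕ.s≤s (ℕ.s≤s ℕ.z≤n)) θs θs>0 θs≤1 Σθ>1 N@(suc N-1) prime 2<θ²N X θsN≤|X| n =
  cleared-≤⇒≤ℕtoℚ E power-scaled E>0 (subst (λ c → (m ℕ.* m ℕ.* N) ℕ.^ j ℕ.* (m ℕ.* N) ≤ E ℕ.* c) (sym ν≡count)
    (lower-bound m>0 m≤D DD+mD≤mmN j (items X ms) (length-tabulate (λ i → item (χ (X i)) (ms i))) admissible total 0))
  where
  open ClearDenominators j θs θs>0 θs≤1 Σθ>1 N 2<θ²N
  open Counting N-1 n using (item; weight; count)
  open LowerBound N-1 prime n
  open TupleCounting N-1 n
  admissible : All (Admissible m D) (items X ms)
  admissible = tabulate⁺ λ i → record
    { periodic = χ-periodic (X i)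
    ; m≤weight = m≤ms i
    ; weight≤D = ms≤D i
    ; dense    = subst (λ c → ms i ℕ.* N ≤ D ℕ.* c) (sym (card-χ (X i))) (ms-dense i (θsN≤|X| i))
    }
  total : suc (3 ℕ.* j) ℕ.* m ℕ.+ D ≤ totalWeight (items X ms)
  total = subst (suc (3 ℕ.* j) ℕ.* m ℕ.+ D ≤_) (cong sum (sym (map-tabulate (λ i → item (χ (X i)) (ms i)) weight))) total-weight
  ν≡count : ν N k X n ≡ count (items X ms) 0
  ν≡count = trans (ν≡sum-accepts k X) (sum-accepts≡count k X ms 0)
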